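{- Let $G$ be a finite special bowtie-free graph and let $p:U\to V$ be a graph isomorphism between induced subgraphs $U,V$ of $G$ such that $U$ and $V$ are themselves special bowtie-free graphs. Then there is a finite special bowtie-free graph $K$ containing $G$ as an induced subgraph and an automorphism $f$ of $K$ extending $p$.
   Context: Graphs are simple and undirected. A bowtie is the graph obtained from two triangles by identifying one vertex of each; a graph is bowtie-free if it has no (not necessarily induced) subgraph isomorphic to the bowtie. A chimney is the free amalgam of two or more triangles over one common edge (i.e. an edge $\{a,b\}$ together with $h\ge 2$ further vertices each adjacent to exactly $a$ and $b$ within the chimney). A bowtie-free graph is special if every vertex lies in a subgraph isomorphic to $K_4$ or in a subgraph isomorphic to a chimney. -}

module Defs where

open import Data.Bool using (Bool; true; false; _∨_; T)
open import Data.Bool.Properties using (∨-comm)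
open import Data.Nat using (ℕ; zero; suc; _≤_)
open import Data.Fin using (Fin; zero; suc; toℕ)
open import Data.Product using (Σ; ∃; _×_; _,_; proj₁)
open import Data.Sum using (_⊎_)
open import Relation.Nullary using (¬_)
open import Relation.Binary.PropositionalEquality using (_≡_; refl)
open import Function.Bundles using (_⤖_; Bijection)
open import Function.Definitions using (Injective)

record Graph (V : Set) : Set where
  field
    adj    : V → V → Bool
    sym    : ∀ x y → adj x y ≡ adj y x
    irrefl : ∀ x → adj x x ≡ false
open Graph public

Edge : ∀ {V} → Graph V → V → V → Set
Edge G x y = T (adj G x y)

fromOriented : ∀ {n} (o : Fin n → Fin n → Bool) → (∀ x → o x x ≡ false) → Graph (Fin n)
fromOriented o oirr = record
  { adj = λ x y → o x y ∨ o y x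
  ; sym = λ x y → ∨-comm (o x y) (o y x)
  ; irrefl = λ x → irr x }
  where
  irr : ∀ x → o x x ∨ o x x ≡ false
  irr x with o x x | oirr x
  ... | false | refl = refl

k4o : Fin 4 → Fin 4 → Bool
k4o zero (suc _) = true
k4o (suc zero) (suc (suc _)) = true
k4o (suc (suc zero)) (suc (suc (suc _))) = true
k4o _ _ = false

k4oIrr : ∀ x → k4o x x ≡ false
k4oIrr zero = refl
k4oIrr (suc zero) = refl
k4oIrr (suc (suc zero)) = refl
k4oIrr (suc (suc (suc zero))) = refl

K4 : Graph (Fin 4)
K4 = fromOriented k4o k4oIrr

-- Bowtie on vertices 0..4: triangles {0,1,2} and {0,3,4} sharing vertex 0.
bowN : ℕ → ℕ → Bool
bowN 0 1 = true
bowN 0 2 = true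
bowN 0 3 = true
bowN 0 4 = true
bowN 1 2 = true
bowN 3 4 = true
bowN _ _ = false

bowNIrr : ∀ k → bowN k k ≡ false
bowNIrr 0 = refl
bowNIrr 1 = refl
bowNIrr 2 = refl
bowNIrr 3 = refl
bowNIrr 4 = refl
bowNIrr (suc (suc (suc (suc (suc k))))) = refl

Bowtie : Graph (Fin 5)
Bowtie = fromOriented (λ x y → bowN (toℕ x) (toℕ y)) (λ x → bowNIrr (toℕ x))

-- Chimney with h apex vertices: vertices 0 = a, 1 = b, and 2..h+1 each adjacent
-- to exactly a and b; plus the edge ab.  (A chimney requires h ≥ 2.)
chO : ∀ {h} → Fin (2 Data.Nat.+ h) → Fin (2 Data.Nat.+ h) → Bool
chO zero (suc _) = true
chO (suc zero) (suc (suc _)) = true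
chO _ _ = false

chOIrr : ∀ {h} (x : Fin (2 Data.Nat.+ h)) → chO x x ≡ false
chOIrr zero = refl
chOIrr (suc zero) = refl
chOIrr (suc (suc x)) = refl

Chimney : (h : ℕ) → Graph (Fin (2 Data.Nat.+ h))
Chimney h = fromOriented chO chOIrr

record SubgraphEmb {A B : Set} (H : Graph A) (G : Graph B) : Set where
  field
    map   : A → B
    inj   : Injective _≡_ _≡_ map
    edges : ∀ x y → Edge H x y → Edge G (map x) (map y)
open SubgraphEmb public

BowtieFree : ∀ {V} → Graph V → Set
BowtieFree G = ¬ SubgraphEmb Bowtie G

Special : ∀ {V} → Graph V → Set
Special {V} G = ∀ (v : V) →
    (Σ (SubgraphEmb K4 G) λ e → ∃ λ x → map e x ≡ v)
  ⊎ (Σ ℕ λ h → 2 ≤ h × Σ (SubgraphEmb (Chimney h) G) λ e → ∃ λ x → map e x ≡ v)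

SpecialBowtieFree : ∀ {V} → Graph V → Set
SpecialBowtieFree G = BowtieFree G × Special G

Subset : ℕ → Set
Subset n = Fin n → Bool

Elem : ∀ {n} → Subset n → Set
Elem {n} S = Σ (Fin n) (λ v → T (S v))

Induced : ∀ {n} → Graph (Fin n) → (S : Subset n) → Graph (Elem S)
Induced G S = record
  { adj = λ x y → adj G (proj₁ x) (proj₁ y)
  ; sym = λ x y → sym G (proj₁ x) (proj₁ y)
  ; irrefl = λ x → irrefl G (proj₁ x) }

record Iso {A B : Set} (G : Graph A) (H : Graph B) : Set where
  field
    bij  : A ⤖ B
    pres : ∀ x y → adj H (Bijection.to bij x) (Bijection.to bij y) ≡ adj G x y
open Iso public

isoMap : ∀ {A B} {G : Graph A} {H : Graph B} → Iso G H → A → B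
isoMap p = Bijection.to (bij p)

Automorphism : ∀ {A} → Graph A → Set
Automorphism G = Iso G G

record InducedEmb {A B : Set} (G : Graph A) (K : Graph B) : Set where
  field
    emb  : A → B
    einj : Injective _≡_ _≡_ emb
    epres : ∀ x y → adj K (emb x) (emb y) ≡ adj G x y
open InducedEmb public

-- The extension K is an orbit graph: take copies G × ℤ/N of G and glue the copy of u ∈ U at
-- time t + 1 to the copy of p u at time t. Shifting time by one is then an automorphism that
-- extends p, copy 0 is an induced copy of G (p preserves adjacency both ways), and K is special
-- because it is covered by copies of G. With N = (3n+1)! every p-cycle closes up, and a vertex
-- on a p-chain occurs in at most n+1 consecutive copies; three pairwise overlapping such arcs
-- of a cycle longer than 3n share a copy, so every triangle of K lies in a single copy.
-- For bowtie-freeness, two triangles through a vertex v lie in copies t and t + m that are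
-- joined by a walk along p through vertices of W. A K4 or chimney of W at such a vertex
-- certifies the shape of all triangles through it in G (inside a fixed K4, all through a fixed
-- hub, or a single triangle); pulled back along p, the same certificate describes the next
-- copy. So one shape propagates along the walk, and it forces the two triangles to share a
-- second vertex.

module Submission where

open import Defs hiding (sym)
open import Data.Bool using (Bool; true; false; T; not; _∨_)
open import Data.Bool.Properties using (T-irrelevant; T-∨)
open import Data.Empty using (⊥; ⊥-elim)
open import Data.Fin using (Fin; zero; suc; toℕ)
open import Data.Fin.Patterns using (0F; 1F; 2F; 3F; 4F)
open import Data.Fin.Properties
  using (*↔×; pigeonhole; toℕ<n; toℕ-injective; toℕ-fromℕ<; suc-injective; any?) renaming (_≟_ to _≟ᶠ_)
open import Data.Maybe using (Maybe; just; nothing; _>>=_)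
open import Data.Maybe.Properties using (just-injective)
open import Data.Nat using (ℕ; zero; suc; pred; _+_; _*_; _∸_; _≤_; _<_; z≤n; s≤s; s≤s⁻¹; _%_; _/_; _!)
open import Data.Nat.DivMod
  using (_mod_; m%n<n; m<n⇒m%n≡m; m%n%n≡m%n; [m+n]%n≡m%n; [m+kn]%n≡m%n; %-distribˡ-+; m≡m%n+[m/n]*n)
open import Data.Nat.Divisibility using (divides; ∣-trans; m∣m*n; m≤n⇒m!∣n!)
open import Data.Nat.Properties hiding (suc-injective)
open import Data.Nat.Tactic.RingSolver using (solve-∀)
open import Data.Product using (Σ; ∃; _×_; _,_; proj₁; proj₂)
open import Data.Product.Function.Dependent.Propositional using (Σ-↔)
open import Data.Product.Properties using (≡-dec)
open import Data.Sum using (_⊎_; inj₁; inj₂)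
open import Data.Unit using (⊤; tt)
open import Data.Vec using (Vec; []; _∷_; lookup)
open import Data.Vec.Relation.Unary.All using ([]; _∷_)
open import Data.Vec.Relation.Unary.AllPairs using ([]; _∷_)
open import Data.Vec.Relation.Unary.Unique.Propositional.Properties using (lookup-injective)
open import Function using (_∘_; case_of_)
open import Function.Bundles using (_↔_; mk↔ₛ′; mk⤖; Inverse; Bijection; Equivalence)
open import Function.Properties.Bijection using (⤖⇒↔)
open import Function.Properties.Inverse using (↔-refl; ↔-sym; ↔-trans; ↔⇒⤖)
open import Relation.Binary.Definitions using (DecidableEquality)
open import Relation.Binary.PropositionalEquality
open import Relation.Nullary using (¬_; Dec; yes; no; does; contradiction)
open import Relation.Nullary.Decidable using (T?; _×-dec_; map′; does-≡; dec-false)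

T-ext : ∀ {a b} → (T a → T b) → (T b → T a) → a ≡ b
T-ext {false} {false} _ _ = refl
T-ext {false} {true}  _ g = ⊥-elim (g _)
T-ext {true}  {false} f _ = ⊥-elim (f _)
T-ext {true}  {true}  _ _ = refl

module _ {A B C : Set} {X : Graph A} {H : Graph B} {G : Graph C} where

  _∘ₑ_ : SubgraphEmb H G → SubgraphEmb X H → SubgraphEmb X G
  f ∘ₑ g = record
    { map   = map f ∘ map g
    ; inj   = inj g ∘ inj f
    ; edges = λ x y → edges f (map g x) (map g y) ∘ edges g x y }

module _ {A B : Set} {H : Graph A} {G : Graph B} where

  bowtieFree-reflect : SubgraphEmb H G → BowtieFree G → BowtieFree H
  bowtieFree-reflect e bf b = bf (e ∘ₑ b)

  special-cover : Special H → (∀ v → Σ (SubgraphEmb H G) λ e → ∃ λ x → map e x ≡ v) → Special G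
  special-cover sp cover v with cover v
  ... | e , x , refl with sp x
  ... | inj₁ (k , y , refl) = inj₁ (e ∘ₑ k , y , refl)
  ... | inj₂ (h , 2≤h , c , y , refl) = inj₂ (h , 2≤h , e ∘ₑ c , y , refl)

module _ {A B : Set} {G : Graph A} {H : Graph B} (f : InducedEmb G H) where

  edge-emb : ∀ {x y} → Edge G x y → Edge H (emb f x) (emb f y)
  edge-emb {x} {y} = subst T (sym (epres f x y))

  nonEdge-emb : ∀ {x y} → ¬ Edge G x y → ¬ Edge H (emb f x) (emb f y)
  nonEdge-emb {x} {y} x≁y = x≁y ∘ subst T (epres f x y)

  subgraphEmb : SubgraphEmb G H
  subgraphEmb = record { map = emb f ; inj = einj f ; edges = λ _ _ → edge-emb }

module _ {A B C : Set} {G : Graph A} {H : Graph B} {K : Graph C} where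

  _∘ᵢ_ : InducedEmb H K → InducedEmb G H → InducedEmb G K
  f ∘ᵢ g = record
    { emb   = emb f ∘ emb g
    ; einj  = einj g ∘ einj f
    ; epres = λ x y → trans (epres f (emb g x) (emb g y)) (epres g x y) }

inclusion : ∀ {n} (G : Graph (Fin n)) (S : Subset n) → InducedEmb (Induced G S) G
inclusion G S = record
  { emb   = proj₁
  ; einj  = λ { {x , h} {.x , h′} refl → cong (x ,_) (T-irrelevant h h′) }
  ; epres = λ _ _ → refl }

iso⁻¹-emb : ∀ {A B} {G : Graph A} {H : Graph B} → Iso G H → InducedEmb H G
iso⁻¹-emb {H = H} f = record
  { emb   = from
  ; einj  = λ {x} {y} q → trans (sym (strictlyInverseˡ x)) (trans (cong to q) (strictlyInverseˡ y))
  ; epres = λ x y → trans (sym (pres f (from x) (from y))) (cong₂ (adj H) (strictlyInverseˡ x) (strictlyInverseˡ y)) }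
  where open Inverse (⤖⇒↔ (bij f))

module Relabel {A : Set} {m : ℕ} (H : Graph A) (e : Fin m ↔ A) where
  open Inverse e renaming (strictlyInverseˡ to to∘from; strictlyInverseʳ to from∘to)

  relabelled : Graph (Fin m)
  relabelled = record
    { adj    = λ i j → adj H (to i) (to j)
    ; sym    = λ i j → Graph.sym H (to i) (to j)
    ; irrefl = λ i → irrefl H (to i) }

  to-injective : ∀ {i j} → to i ≡ to j → i ≡ j
  to-injective {i} {j} q = trans (sym (from∘to i)) (trans (cong from q) (from∘to j))

  from-injective : ∀ {a b} → from a ≡ from b → a ≡ b
  from-injective {a} {b} q = trans (sym (to∘from a)) (trans (cong to q) (to∘from b))

  adj-from : ∀ a b → adj relabelled (from a) (from b) ≡ adj H a b
  adj-from a b = cong₂ (adj H) (to∘from a) (to∘from b)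

  to-embedding : SubgraphEmb relabelled H
  to-embedding = record { map = to ; inj = to-injective ; edges = λ _ _ h → h }

  from-embedding : SubgraphEmb H relabelled
  from-embedding = record
    { map = from ; inj = from-injective ; edges = λ a b → subst T (sym (adj-from a b)) }

  bowtieFree : BowtieFree H → BowtieFree relabelled
  bowtieFree = bowtieFree-reflect to-embedding

  special : Special H → Special relabelled
  special sp = special-cover sp λ i → from-embedding , to i , from∘to i

  inducedEmb : ∀ {B} {X : Graph B} → InducedEmb X H → InducedEmb X relabelled
  inducedEmb f = record
    { emb   = from ∘ emb f
    ; einj  = einj f ∘ from-injective
    ; epres = λ x y → trans (adj-from (emb f x) (emb f y)) (epres f x y) }

  automorphism : Automorphism H → Automorphism relabelled
  automorphism f = record
    { bij  = ↔⇒⤖ (↔-trans e (↔-trans (⤖⇒↔ (bij f)) (↔-sym e)))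
    ; pres = λ i j → trans (adj-from (isoMap f (to i)) (isoMap f (to j))) (pres f (to i) (to j)) }

  automorphism-from : ∀ f a → isoMap (automorphism f) (from a) ≡ from (isoMap f a)
  automorphism-from f a = cong (from ∘ isoMap f) (to∘from a)

Enumeration : Set → Set
Enumeration A = Σ ℕ λ m → Fin m ↔ A

enumerate-filter : ∀ k (P : Fin k → Bool) → Enumeration (Σ (Fin k) (T ∘ P))
enumerate-filter zero P = 0 , mk↔ₛ′ (λ ()) (λ { (() , _) }) (λ { (() , _) }) (λ ())
enumerate-filter (suc k) P with P zero in P0 | enumerate-filter k (P ∘ suc)
... | true | m , e = suc m , mk↔ₛ′ to from to∘from from∘to
  where
  open Inverse e renaming (to to toₖ; from to fromₖ)
  to : Fin (suc m) → Σ (Fin (suc k)) (T ∘ P)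
  to zero    = zero , subst T (sym P0) _
  to (suc i) = suc (proj₁ (toₖ i)) , proj₂ (toₖ i)
  from : Σ (Fin (suc k)) (T ∘ P) → Fin (suc m)
  from (zero , _)  = zero
  from (suc i , h) = suc (fromₖ (i , h))
  to∘from : ∀ a → to (from a) ≡ a
  to∘from (zero , h)  = cong (zero ,_) (T-irrelevant _ h)
  to∘from (suc i , h) = cong (λ a → suc (proj₁ a) , proj₂ a) (strictlyInverseˡ (i , h))
  from∘to : ∀ i → from (to i) ≡ i
  from∘to zero    = refl
  from∘to (suc i) = cong suc (strictlyInverseʳ i)
... | false | m , e = m , mk↔ₛ′ to from to∘from from∘to
  where
  open Inverse e renaming (to to toₖ; from to fromₖ)
  to : Fin m → Σ (Fin (suc k)) (T ∘ P)
  to i = suc (proj₁ (toₖ i)) , proj₂ (toₖ i)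
  from : Σ (Fin (suc k)) (T ∘ P) → Fin m
  from (zero , h)  = ⊥-elim (subst T P0 h)
  from (suc i , h) = fromₖ (i , h)
  to∘from : ∀ a → to (from a) ≡ a
  to∘from (zero , h)  = ⊥-elim (subst T P0 h)
  to∘from (suc i , h) = cong (λ a → suc (proj₁ a) , proj₂ a) (strictlyInverseˡ (i , h))
  from∘to : ∀ i → from (to i) ≡ i
  from∘to = strictlyInverseʳ

enumerate-product-filter : ∀ a b (P : Fin a × Fin b → Bool) → Enumeration (Σ (Fin a × Fin b) (T ∘ P))
enumerate-product-filter a b P with enumerate-filter (a * b) (P ∘ Inverse.to *↔×)
... | m , e = m , ↔-trans e (Σ-↔ *↔× ↔-refl)

module _ {V : Set} (G : Graph V) where

  Edge-sym : ∀ {x y} → Edge G x y → Edge G y x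
  Edge-sym {x} {y} = subst T (Graph.sym G x y)

  Edge-irrefl : ∀ {x y} → Edge G x y → x ≢ y
  Edge-irrefl {x} e refl = subst T (irrefl G x) e

  orientedEdges : ∀ {n} (o : Fin n → Fin n → Bool) o-irr (f : Fin n → V) →
                  (∀ x y → T (o x y) → Edge G (f x) (f y)) →
                  ∀ x y → Edge (fromOriented o o-irr) x y → Edge G (f x) (f y)
  orientedEdges o _ f e x y h with Equivalence.to T-∨ h
  ... | inj₁ xy = e x y xy
  ... | inj₂ yx = Edge-sym (e y x yx)

  Triangle : V → V → V → Set
  Triangle w a b = Edge G w a × Edge G w b × Edge G a b

  triangle-swap : ∀ {w a b} → Triangle w a b → Triangle w b a
  triangle-swap (wa , wb , ab) = wb , wa , Edge-sym ab

  triangle-rotate : ∀ {w a b} → Triangle w a b → Triangle a w b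
  triangle-rotate (wa , wb , ab) = Edge-sym wa , ab , wb

  bowtie-embedding : ∀ {v a b c d} → Triangle v a b → Triangle v c d →
                     a ≢ c → a ≢ d → b ≢ c → b ≢ d → SubgraphEmb Bowtie G
  bowtie-embedding {v} {a} {b} {c} {d} (va , vb , ab) (vc , vd , cd) a≢c a≢d b≢c b≢d = record
    { map   = lookup vertices
    ; inj   = lookup-injective distinct _ _
    ; edges = orientedEdges _ (λ x → bowNIrr (toℕ x)) (lookup vertices) oriented }
    where
    vertices : Vec V 5
    vertices = v ∷ a ∷ b ∷ c ∷ d ∷ []
    distinct = (Edge-irrefl va ∷ Edge-irrefl vb ∷ Edge-irrefl vc ∷ Edge-irrefl vd ∷ [])
             ∷ (Edge-irrefl ab ∷ a≢c ∷ a≢d ∷ [])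
             ∷ (b≢c ∷ b≢d ∷ [])
             ∷ (Edge-irrefl cd ∷ [])
             ∷ [] ∷ []
    -- the coverage checker discharges the remaining pairs, for which T (bowN …) is empty
    oriented : ∀ x y → T (bowN (toℕ x) (toℕ y)) → Edge G (lookup vertices x) (lookup vertices y)
    oriented zero (suc zero) _ = va
    oriented zero (suc (suc zero)) _ = vb
    oriented zero (suc (suc (suc zero))) _ = vc
    oriented zero (suc (suc (suc (suc zero)))) _ = vd
    oriented (suc zero) (suc (suc zero)) _ = ab
    oriented (suc (suc (suc zero))) (suc (suc (suc (suc zero)))) _ = cd

module _ {A B : Set} {G : Graph A} {H : Graph B} (f : InducedEmb G H) where

  triangle-emb : ∀ {w a b} → Triangle G w a b → Triangle H (emb f w) (emb f a) (emb f b)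
  triangle-emb (wa , wb , ab) = edge-emb f wa , edge-emb f wb , edge-emb f ab

-- Shapes of families of triangles

Meets : {A : Set} → A → A → A → A → Set
Meets a b c d = (a ≡ c ⊎ a ≡ d) ⊎ (b ≡ c ⊎ b ≡ d)

OneOf : {A : Set} → A → A → A → A → Set
OneOf x a b c = x ≡ a ⊎ x ≡ b ⊎ x ≡ c

Collision : {A : Set} → A → A → A → A → Set
Collision a b c d = Meets a b c d ⊎ (a ≡ b ⊎ c ≡ d)

data Shape (A : Set) : Set where
  clique : A → A → A → Shape A
  hub    : A → Shape A
  edge   : A → A → Shape A

Admits : {A : Set} → Shape A → A → A → Set
Admits (clique a b c) x y = OneOf x a b c × OneOf y a b c
Admits (hub z)        x y = x ≡ z ⊎ y ≡ z
Admits (edge a b)     x y = (x ≡ a × y ≡ b) ⊎ (x ≡ b × y ≡ a)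

mapShape : {A B : Set} → (A → B) → Shape A → Shape B
mapShape f (clique a b c) = clique (f a) (f b) (f c)
mapShape f (hub z)        = hub (f z)
mapShape f (edge a b)     = edge (f a) (f b)

mapShape-∘ : ∀ {A B C : Set} (f : B → C) (g : A → B) σ → mapShape f (mapShape g σ) ≡ mapShape (f ∘ g) σ
mapShape-∘ f g (clique _ _ _) = refl
mapShape-∘ f g (hub _)        = refl
mapShape-∘ f g (edge _ _)     = refl

mapShape-cong : ∀ {A B : Set} {f g : A → B} → (∀ x → f x ≡ g x) → ∀ σ → mapShape f σ ≡ mapShape g σ
mapShape-cong f≗g (clique a b c) rewrite f≗g a | f≗g b | f≗g c = refl
mapShape-cong f≗g (hub z)        = cong hub (f≗g z)
mapShape-cong f≗g (edge a b)     = cong₂ edge (f≗g a) (f≗g b)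

admits-map : ∀ {A B : Set} (f : A → B) σ {x y} → Admits σ x y → Admits (mapShape f σ) (f x) (f y)
admits-map f (clique _ _ _) (x , y) = oneOf-map x , oneOf-map y
  where
  oneOf-map : ∀ {x a b c} → OneOf x a b c → OneOf (f x) (f a) (f b) (f c)
  oneOf-map (inj₁ refl)        = inj₁ refl
  oneOf-map (inj₂ (inj₁ refl)) = inj₂ (inj₁ refl)
  oneOf-map (inj₂ (inj₂ refl)) = inj₂ (inj₂ refl)
admits-map f (hub _) (inj₁ refl) = inj₁ refl
admits-map f (hub _) (inj₂ refl) = inj₂ refl
admits-map f (edge _ _) (inj₁ (refl , refl)) = inj₁ (refl , refl)
admits-map f (edge _ _) (inj₂ (refl , refl)) = inj₂ (refl , refl)

module _ {A : Set} where

  private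
    pigeon₂ : ∀ {b c d r s : A} → b ≡ r ⊎ b ≡ s → c ≡ r ⊎ c ≡ s → d ≡ r ⊎ d ≡ s → b ≡ c ⊎ b ≡ d ⊎ c ≡ d
    pigeon₂ (inj₁ refl) (inj₁ refl) _           = inj₁ refl
    pigeon₂ (inj₂ refl) (inj₂ refl) _           = inj₁ refl
    pigeon₂ (inj₁ refl) (inj₂ refl) (inj₁ refl) = inj₂ (inj₁ refl)
    pigeon₂ (inj₁ refl) (inj₂ refl) (inj₂ refl) = inj₂ (inj₂ refl)
    pigeon₂ (inj₂ refl) (inj₁ refl) (inj₁ refl) = inj₂ (inj₂ refl)
    pigeon₂ (inj₂ refl) (inj₁ refl) (inj₂ refl) = inj₂ (inj₁ refl)

    pigeon-first : ∀ {a b c d r s t : A} → a ≡ r → OneOf b r s t → OneOf c r s t → OneOf d r s t →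
                   Collision a b c d
    pigeon-first refl (inj₁ refl) _ _                     = inj₂ (inj₁ refl)
    pigeon-first refl (inj₂ _) (inj₁ refl) _              = inj₁ (inj₁ (inj₁ refl))
    pigeon-first refl (inj₂ _) (inj₂ _) (inj₁ refl)       = inj₁ (inj₁ (inj₂ refl))
    pigeon-first refl (inj₂ b) (inj₂ c) (inj₂ d) with pigeon₂ b c d
    ... | inj₁ b≡c          = inj₁ (inj₂ (inj₁ b≡c))
    ... | inj₂ (inj₁ b≡d)   = inj₁ (inj₂ (inj₂ b≡d))
    ... | inj₂ (inj₂ c≡d)   = inj₂ (inj₂ c≡d)

    rotate : ∀ {x r s t : A} → OneOf x r s t → OneOf x s t r
    rotate (inj₁ q)        = inj₂ (inj₂ q)
    rotate (inj₂ (inj₁ q)) = inj₁ q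
    rotate (inj₂ (inj₂ q)) = inj₂ (inj₁ q)

  pigeon₃ : ∀ {a b c d r s t : A} → OneOf a r s t → OneOf b r s t → OneOf c r s t → OneOf d r s t →
            Collision a b c d
  pigeon₃ (inj₁ a) b c d        = pigeon-first a b c d
  pigeon₃ (inj₂ (inj₁ a)) b c d = pigeon-first a (rotate b) (rotate c) (rotate d)
  pigeon₃ (inj₂ (inj₂ a)) b c d = pigeon-first a (rotate (rotate b)) (rotate (rotate c)) (rotate (rotate d))

  admits-collision : ∀ σ {a b c d : A} → Admits σ a b → Admits σ c d → Collision a b c d
  admits-collision (clique _ _ _) (a , b) (c , d) = pigeon₃ a b c d
  admits-collision (hub _) (inj₁ refl) (inj₁ refl) = inj₁ (inj₁ (inj₁ refl))
  admits-collision (hub _) (inj₁ refl) (inj₂ refl) = inj₁ (inj₁ (inj₂ refl))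
  admits-collision (hub _) (inj₂ refl) (inj₁ refl) = inj₁ (inj₂ (inj₁ refl))
  admits-collision (hub _) (inj₂ refl) (inj₂ refl) = inj₁ (inj₂ (inj₂ refl))
  admits-collision (edge _ _) (inj₁ (refl , _)) (inj₁ (refl , _)) = inj₁ (inj₁ (inj₁ refl))
  admits-collision (edge _ _) (inj₁ (refl , _)) (inj₂ (_ , refl)) = inj₁ (inj₁ (inj₂ refl))
  admits-collision (edge _ _) (inj₂ (refl , _)) (inj₁ (_ , refl)) = inj₁ (inj₁ (inj₂ refl))
  admits-collision (edge _ _) (inj₂ (refl , _)) (inj₂ (refl , _)) = inj₁ (inj₁ (inj₁ refl))

collision-swap : ∀ {A : Set} {a b c d : A} → Collision a b c d → Collision c d a b
collision-swap (inj₁ (inj₁ (inj₁ refl))) = inj₁ (inj₁ (inj₁ refl))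
collision-swap (inj₁ (inj₁ (inj₂ refl))) = inj₁ (inj₂ (inj₁ refl))
collision-swap (inj₁ (inj₂ (inj₁ refl))) = inj₁ (inj₁ (inj₂ refl))
collision-swap (inj₁ (inj₂ (inj₂ refl))) = inj₁ (inj₂ (inj₂ refl))
collision-swap (inj₂ (inj₁ a≡b))         = inj₂ (inj₂ a≡b)
collision-swap (inj₂ (inj₂ c≡d))         = inj₂ (inj₁ c≡d)

collision-injective : ∀ {A : Set} {f : Fin 5 → A} → (∀ {i j} → f i ≡ f j → i ≡ j) →
                      ¬ Collision (f 1F) (f 2F) (f 3F) (f 4F)
collision-injective inj (inj₁ (inj₁ (inj₁ q))) with () ← inj q
collision-injective inj (inj₁ (inj₁ (inj₂ q))) with () ← inj q
collision-injective inj (inj₁ (inj₂ (inj₁ q))) with () ← inj q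
collision-injective inj (inj₁ (inj₂ (inj₂ q))) with () ← inj q
collision-injective inj (inj₂ (inj₁ q))        with () ← inj q
collision-injective inj (inj₂ (inj₂ q))        with () ← inj q

-- Certificates in bowtie-free graphs

module _ {V : Set} (G : Graph V) where

  data Certificate (w : V) : Shape V → Set where
    clique : ∀ {a b c} → Triangle G w a b → Triangle G w a c → Triangle G w b c → Certificate w (clique a b c)
    hub    : ∀ {z x y} → Triangle G w z x → Triangle G w z y → x ≢ y → ¬ Edge G x y → Certificate w (hub z)
    edge   : ∀ {a b x} → Triangle G w a b → Edge G a x → Edge G b x → x ≢ w → ¬ Edge G w x → Certificate w (edge a b)

module BowtieFreeGraph {V : Set} (_≟_ : DecidableEquality V) (G : Graph V) (bowtieFree : BowtieFree G) where

  triangles-meet : ∀ {w a b c d} → Triangle G w a b → Triangle G w c d → Meets a b c d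
  triangles-meet {a = a} {b} {c} {d} t t′ with a ≟ c | a ≟ d | b ≟ c | b ≟ d
  ... | yes q | _     | _     | _     = inj₁ (inj₁ q)
  ... | no _  | yes q | _     | _     = inj₁ (inj₂ q)
  ... | no _  | no _  | yes q | _     = inj₂ (inj₁ q)
  ... | no _  | no _  | no _  | yes q = inj₂ (inj₂ q)
  ... | no ac | no ad | no bc | no bd = ⊥-elim (bowtieFree (bowtie-embedding G t t′ ac ad bc bd))

  clique-bound : ∀ {w a b c x y} → Triangle G w a b → Triangle G w a c → Triangle G w b c →
                 Triangle G w x y → OneOf x a b c
  clique-bound {a = a} {b} {c} {x} tab tac tbc txy with x ≟ a | x ≟ b | x ≟ c
  ... | yes q | _     | _     = inj₁ q
  ... | no _  | yes q | _     = inj₂ (inj₁ q)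
  ... | no _  | no _  | yes q = inj₂ (inj₂ q)
  ... | no xa | no xb | no xc
    with triangles-meet tab txy | triangles-meet tac txy | triangles-meet tbc txy
  ... | inj₁ (inj₁ q) | _ | _ = contradiction (sym q) xa
  ... | inj₂ (inj₁ q) | _ | _ = contradiction (sym q) xb
  ... | _ | inj₁ (inj₁ q) | _ = contradiction (sym q) xa
  ... | _ | inj₂ (inj₁ q) | _ = contradiction (sym q) xc
  ... | _ | _ | inj₁ (inj₁ q) = contradiction (sym q) xb
  ... | _ | _ | inj₂ (inj₁ q) = contradiction (sym q) xc
  ... | inj₁ (inj₂ refl) | _ | inj₁ (inj₂ q) = ⊥-elim (Edge-irrefl G (proj₂ (proj₂ tab)) (sym q))
  ... | inj₁ (inj₂ refl) | _ | inj₂ (inj₂ q) = ⊥-elim (Edge-irrefl G (proj₂ (proj₂ tac)) (sym q))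
  ... | inj₂ (inj₂ refl) | inj₁ (inj₂ q) | _ = ⊥-elim (Edge-irrefl G (proj₂ (proj₂ tab)) q)
  ... | inj₂ (inj₂ refl) | inj₂ (inj₂ q) | _ = ⊥-elim (Edge-irrefl G (proj₂ (proj₂ tbc)) (sym q))

  hub-bound : ∀ {w z x₀ y₀ x y} → Triangle G w z x₀ → Triangle G w z y₀ → x₀ ≢ y₀ → ¬ Edge G x₀ y₀ →
              Triangle G w x y → x ≡ z ⊎ y ≡ z
  hub-bound {z = z} {x = x} {y} t₀ t₁ x₀≢y₀ x₀≁y₀ txy with x ≟ z | y ≟ z
  ... | yes q | _     = inj₁ q
  ... | no _  | yes q = inj₂ q
  ... | no xz | no yz with triangles-meet t₀ txy | triangles-meet t₁ txy
  ... | inj₁ (inj₁ q) | _ = contradiction (sym q) xz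
  ... | inj₁ (inj₂ q) | _ = contradiction (sym q) yz
  ... | _ | inj₁ (inj₁ q) = contradiction (sym q) xz
  ... | _ | inj₁ (inj₂ q) = contradiction (sym q) yz
  ... | inj₂ (inj₁ q) | inj₂ (inj₁ q′) = ⊥-elim (x₀≢y₀ (trans q (sym q′)))
  ... | inj₂ (inj₂ q) | inj₂ (inj₂ q′) = ⊥-elim (x₀≢y₀ (trans q (sym q′)))
  ... | inj₂ (inj₁ refl) | inj₂ (inj₂ refl) = ⊥-elim (x₀≁y₀ (proj₂ (proj₂ txy)))
  ... | inj₂ (inj₂ refl) | inj₂ (inj₁ refl) = ⊥-elim (x₀≁y₀ (Edge-sym G (proj₂ (proj₂ txy))))

  private
    edge-partner : ∀ {w a b x₀ y} → Triangle G w a b → Edge G a x₀ → Edge G b x₀ → x₀ ≢ w → ¬ Edge G w x₀ →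
                   Triangle G w a y → y ≡ b
    edge-partner {b = b} {y = y} tab ax bx x≢w w≁x tay with y ≟ b
    ... | yes q = q
    ... | no y≢b with triangles-meet (triangle-rotate G tay) (proj₂ (proj₂ tab) , ax , bx)
    ... | inj₁ (inj₁ q) = ⊥-elim (Edge-irrefl G (proj₁ (proj₂ tab)) q)
    ... | inj₁ (inj₂ q) = ⊥-elim (x≢w (sym q))
    ... | inj₂ (inj₁ q) = ⊥-elim (y≢b q)
    ... | inj₂ (inj₂ refl) = ⊥-elim (w≁x (proj₁ (proj₂ tay)))

  edge-bound : ∀ {w a b x₀ x y} → Triangle G w a b → Edge G a x₀ → Edge G b x₀ → x₀ ≢ w → ¬ Edge G w x₀ →
               Triangle G w x y → (x ≡ a × y ≡ b) ⊎ (x ≡ b × y ≡ a)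
  edge-bound tab ax bx x≢w w≁x txy with triangles-meet tab txy
  ... | inj₁ (inj₁ refl) = inj₁ (refl , edge-partner tab ax bx x≢w w≁x txy)
  ... | inj₁ (inj₂ refl) = inj₂ (edge-partner tab ax bx x≢w w≁x (triangle-swap G txy) , refl)
  ... | inj₂ (inj₁ refl) = inj₂ (refl , edge-partner (triangle-swap G tab) bx ax x≢w w≁x txy)
  ... | inj₂ (inj₂ refl) = inj₁ (edge-partner (triangle-swap G tab) bx ax x≢w w≁x (triangle-swap G txy) , refl)

  certificate-bound : ∀ {w σ x y} → Certificate G w σ → Triangle G w x y → Admits σ x y
  certificate-bound (clique tab tac tbc) txy =
    clique-bound tab tac tbc txy , clique-bound tab tac tbc (triangle-swap G txy)
  certificate-bound (hub t₀ t₁ x₀≢y₀ x₀≁y₀) = hub-bound t₀ t₁ x₀≢y₀ x₀≁y₀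
  certificate-bound (edge tab ax bx x≢w w≁x) = edge-bound tab ax bx x≢w w≁x

module _ {A B : Set} {G : Graph A} {H : Graph B} (f : InducedEmb G H) where

  certificate-emb : ∀ {w σ} → Certificate G w σ → Certificate H (emb f w) (mapShape (emb f) σ)
  certificate-emb (clique tab tac tbc) =
    clique (triangle-emb f tab) (triangle-emb f tac) (triangle-emb f tbc)
  certificate-emb (hub t₀ t₁ x≢y x≁y) =
    hub (triangle-emb f t₀) (triangle-emb f t₁) (x≢y ∘ einj f) (nonEdge-emb f x≁y)
  certificate-emb (edge tab ax bx x≢w w≁x) =
    edge (triangle-emb f tab) (edge-emb f ax) (edge-emb f bx) (x≢w ∘ einj f) (nonEdge-emb f w≁x)

module _ {V : Set} (G : Graph V) where

  k4-certificate : (e : SubgraphEmb K4 G) → ∀ y → ∃ (Certificate G (map e y))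
  k4-certificate e = certificate
    where
    triangle : ∀ i j k → Edge K4 i j → Edge K4 i k → Edge K4 j k → Triangle G (map e i) (map e j) (map e k)
    triangle i j k ij ik jk = edges e i j ij , edges e i k ik , edges e j k jk
    certificate : ∀ y → ∃ (Certificate G (map e y))
    certificate zero =
      _ , clique (triangle 0F 1F 2F _ _ _) (triangle 0F 1F 3F _ _ _) (triangle 0F 2F 3F _ _ _)
    certificate (suc zero) =
      _ , clique (triangle 1F 0F 2F _ _ _) (triangle 1F 0F 3F _ _ _) (triangle 1F 2F 3F _ _ _)
    certificate (suc (suc zero)) =
      _ , clique (triangle 2F 0F 1F _ _ _) (triangle 2F 0F 3F _ _ _) (triangle 2F 1F 3F _ _ _)
    certificate (suc (suc (suc zero))) =
      _ , clique (triangle 3F 0F 1F _ _ _) (triangle 3F 0F 2F _ _ _) (triangle 3F 1F 2F _ _ _)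

  chimney-certificate : ∀ h (e : SubgraphEmb (Chimney (suc (suc h))) G) → ∀ y → ∃ (Certificate G (map e y))
  chimney-certificate h e = certificate
    where
    C = Chimney (suc (suc h))
    m = map e
    apex-triangle : ∀ {s s′} → Edge C s s′ → (∀ k → Edge C s (suc (suc k))) → (∀ k → Edge C s′ (suc (suc k))) →
                    ∀ k → Triangle G (m s) (m s′) (m (suc (suc k)))
    apex-triangle ss′ s-apex s′-apex k = edges e _ _ ss′ , edges e _ _ (s-apex k) , edges e _ _ (s′-apex k)
    spine : ∀ s s′ → Edge C s s′ → (∀ k → Edge C s (suc (suc k))) → (∀ k → Edge C s′ (suc (suc k))) →
            ∃ (Certificate G (m s))
    spine s s′ ss′ s-apex s′-apex with T? (adj G (m 2F) (m 3F))
    ... | yes apexes = _ , clique (t 0F) (t 1F) (edges e s 2F (s-apex 0F) , edges e s 3F (s-apex 1F) , apexes)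
      where t = apex-triangle ss′ s-apex s′-apex
    ... | no ¬apexes = _ , hub (t 0F) (t 1F) (λ q → case inj e q of λ ()) ¬apexes
      where t = apex-triangle ss′ s-apex s′-apex
    apex : ∀ j k → j ≢ k → ∃ (Certificate G (m (suc (suc j))))
    apex j k j≢k with T? (adj G (m (suc (suc j))) (m (suc (suc k))))
    ... | yes ab = _ , clique (a0 , a1 , edges e 0F 1F _) (a0 , ab , edges e 0F b _) (a1 , ab , edges e 1F b _)
      where
      b = suc (suc k)
      a0 = edges e (suc (suc j)) 0F _
      a1 = edges e (suc (suc j)) 1F _
    ... | no ¬ab = _ , edge (edges e a 0F _ , edges e a 1F _ , edges e 0F 1F _) (edges e 0F b _) (edges e 1F b _)
                         (λ q → j≢k (sym (suc-injective (suc-injective (inj e q))))) ¬ab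
      where
      a = suc (suc j)
      b = suc (suc k)
    certificate : ∀ y → ∃ (Certificate G (m y))
    certificate zero                = spine 0F 1F _ (λ _ → _) (λ _ → _)
    certificate (suc zero)          = spine 1F 0F _ (λ _ → _) (λ _ → _)
    certificate (suc (suc zero))    = apex 0F 1F (λ ())
    certificate (suc (suc (suc j))) = apex (suc j) 0F (λ ())

  special-certificate : Special G → ∀ v → ∃ (Certificate G v)
  special-certificate sp v with sp v
  ... | inj₁ (e , y , refl) = k4-certificate e y
  ... | inj₂ (suc (suc h) , _ , e , y , refl) = chimney-certificate h e y
  ... | inj₂ (suc zero , s≤s () , _)

module Propagation {A : Set} (Adj : A → A → Set) (Adj-sym : ∀ {x y} → Adj x y → Adj y x) where

  _⊑_ : (A → A → Set) → Shape A → Set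
  F ⊑ σ = ∀ {x y} → F x y → Admits σ x y

  Proper : Shape A → Set
  Proper (clique a b c) = a ≢ b × a ≢ c × b ≢ c × Adj a b × Adj a c × Adj b c
  Proper (hub _)        = ⊤
  Proper (edge a b)     = a ≢ b

  data Witnessed (F : A → A → Set) : Shape A → Set where
    clique : ∀ {a b c} → F a b → F a c → F b c → a ≢ b → a ≢ c → b ≢ c → Witnessed F (clique a b c)
    hub    : ∀ {z x y} → F z x → F z y → x ≢ y → ¬ Adj x y → Witnessed F (hub z)
    edge   : ∀ {a b} → F a b → a ≢ b → Witnessed F (edge a b)

  witnessed-proper : ∀ {F σ} → (∀ {x y} → F x y → Adj x y) → Witnessed F σ → Proper σ
  witnessed-proper F⇒Adj (clique ab ac bc a≢b a≢c b≢c) = a≢b , a≢c , b≢c , F⇒Adj ab , F⇒Adj ac , F⇒Adj bc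
  witnessed-proper _ (hub _ _ _ _) = tt
  witnessed-proper _ (edge _ a≢b) = a≢b

  private
    clique-adjacent : ∀ {r s t x y} → Proper (clique r s t) → OneOf x r s t → OneOf y r s t → x ≢ y → Adj x y
    clique-adjacent _ (inj₁ refl) (inj₁ refl) x≢y = ⊥-elim (x≢y refl)
    clique-adjacent _ (inj₂ (inj₁ refl)) (inj₂ (inj₁ refl)) x≢y = ⊥-elim (x≢y refl)
    clique-adjacent _ (inj₂ (inj₂ refl)) (inj₂ (inj₂ refl)) x≢y = ⊥-elim (x≢y refl)
    clique-adjacent (_ , _ , _ , rs , rt , st) (inj₁ refl) (inj₂ (inj₁ refl)) _ = rs
    clique-adjacent (_ , _ , _ , rs , rt , st) (inj₁ refl) (inj₂ (inj₂ refl)) _ = rt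
    clique-adjacent (_ , _ , _ , rs , rt , st) (inj₂ (inj₁ refl)) (inj₂ (inj₂ refl)) _ = st
    clique-adjacent (_ , _ , _ , rs , rt , st) (inj₂ (inj₁ refl)) (inj₁ refl) _ = Adj-sym rs
    clique-adjacent (_ , _ , _ , rs , rt , st) (inj₂ (inj₂ refl)) (inj₁ refl) _ = Adj-sym rt
    clique-adjacent (_ , _ , _ , rs , rt , st) (inj₂ (inj₂ refl)) (inj₂ (inj₁ refl)) _ = Adj-sym st

    oneOf-trans : ∀ {x q₁ q₂ q₃ r s t : A} → OneOf q₁ r s t → OneOf q₂ r s t → OneOf q₃ r s t →
                  OneOf x q₁ q₂ q₃ → OneOf x r s t
    oneOf-trans i₁ _ _ (inj₁ refl)        = i₁
    oneOf-trans _ i₂ _ (inj₂ (inj₁ refl)) = i₂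
    oneOf-trans _ _ i₃ (inj₂ (inj₂ refl)) = i₃

  propagate : ∀ {F F′ σ τ} → Proper σ → F ⊑ σ → Witnessed F τ → F′ ⊑ τ → F′ ⊑ σ
  propagate {σ = hub _} _ F⊑σ (clique ab ac bc a≢b a≢c b≢c) _ with F⊑σ ab | F⊑σ ac | F⊑σ bc
  ... | inj₁ refl | _ | inj₁ refl = ⊥-elim (a≢b refl)
  ... | inj₁ refl | _ | inj₂ refl = ⊥-elim (a≢c refl)
  ... | inj₂ refl | inj₁ refl | _ = ⊥-elim (a≢b refl)
  ... | inj₂ refl | inj₂ refl | _ = ⊥-elim (b≢c refl)
  propagate {σ = hub _} _ F⊑σ (hub zx zy x≢y _) F′⊑τ with F⊑σ zx | F⊑σ zy
  ... | inj₁ refl | _         = F′⊑τ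
  ... | inj₂ _    | inj₁ refl = F′⊑τ
  ... | inj₂ refl | inj₂ refl = ⊥-elim (x≢y refl)
  propagate {σ = hub _} _ F⊑σ (edge ab _) F′⊑τ cd with F⊑σ ab | F′⊑τ cd
  ... | inj₁ refl | inj₁ (refl , refl) = inj₁ refl
  ... | inj₁ refl | inj₂ (refl , refl) = inj₂ refl
  ... | inj₂ refl | inj₁ (refl , refl) = inj₂ refl
  ... | inj₂ refl | inj₂ (refl , refl) = inj₁ refl
  propagate {σ = edge _ _} σ-proper F⊑σ (clique ab ac _ _ _ b≢c) _ with F⊑σ ab | F⊑σ ac
  ... | inj₁ (refl , refl) | inj₁ (_ , refl)    = ⊥-elim (b≢c refl)
  ... | inj₁ (refl , refl) | inj₂ (refl , _)    = ⊥-elim (σ-proper refl)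
  ... | inj₂ (refl , refl) | inj₁ (refl , _)    = ⊥-elim (σ-proper refl)
  ... | inj₂ (refl , refl) | inj₂ (_ , refl)    = ⊥-elim (b≢c refl)
  propagate {σ = edge _ _} σ-proper F⊑σ (hub zx zy x≢y _) _ with F⊑σ zx | F⊑σ zy
  ... | inj₁ (refl , refl) | inj₁ (_ , refl)    = ⊥-elim (x≢y refl)
  ... | inj₁ (refl , refl) | inj₂ (refl , _)    = ⊥-elim (σ-proper refl)
  ... | inj₂ (refl , refl) | inj₁ (refl , _)    = ⊥-elim (σ-proper refl)
  ... | inj₂ (refl , refl) | inj₂ (_ , refl)    = ⊥-elim (x≢y refl)
  propagate {σ = edge _ _} _ F⊑σ (edge ab _) F′⊑τ cd with F⊑σ ab | F′⊑τ cd
  ... | inj₁ (refl , refl) | r                  = r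
  ... | inj₂ (refl , refl) | inj₁ (refl , refl) = inj₂ (refl , refl)
  ... | inj₂ (refl , refl) | inj₂ (refl , refl) = inj₁ (refl , refl)
  propagate {σ = clique _ _ _} _ F⊑σ (clique ab ac _ _ _ _) F′⊑τ cd with F⊑σ ab | F⊑σ ac | F′⊑τ cd
  ... | (a , b) | (_ , c) | (x , y) = oneOf-trans a b c x , oneOf-trans a b c y
  propagate {σ = clique _ _ _} σ-proper F⊑σ (hub zx zy x≢y x≁y) _ with F⊑σ zx | F⊑σ zy
  ... | (_ , x) | (_ , y) = ⊥-elim (x≁y (clique-adjacent σ-proper x y x≢y))
  propagate {σ = clique _ _ _} _ F⊑σ (edge ab _) F′⊑τ cd with F⊑σ ab | F′⊑τ cd
  ... | (a , b) | inj₁ (refl , refl) = a , b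
  ... | (a , b) | inj₂ (refl , refl) = b , a

module ImageTriangles {A B : Set} {G : Graph A} {H : Graph B} (e : InducedEmb G H) where
  open Propagation (Edge H) (Edge-sym H)

  Through : B → B → B → Set
  Through v a b = ∃ λ w → ∃ λ x → ∃ λ y → emb e w ≡ v × emb e x ≡ a × emb e y ≡ b × Triangle G w x y

  through⇒edge : ∀ {v a b} → Through v a b → Edge H a b
  through⇒edge (_ , _ , _ , _ , refl , refl , _ , _ , xy) = edge-emb e xy

  certificate-witnessed : ∀ {w σ v} → Certificate G w σ → emb e w ≡ v → Witnessed (Through v) (mapShape (emb e) σ)
  certificate-witnessed (clique tab tac tbc) refl =
    clique (through tab) (through tac) (through tbc)
      (distinct tab) (distinct tac) (distinct tbc)
    where
    through : ∀ {x y} → Triangle G _ x y → Through _ (emb e x) (emb e y)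
    through t = _ , _ , _ , refl , refl , refl , t
    distinct : ∀ {x y} → Triangle G _ x y → emb e x ≢ emb e y
    distinct (_ , _ , xy) = Edge-irrefl G xy ∘ einj e
  certificate-witnessed (hub t₀ t₁ x≢y x≁y) refl =
    hub (_ , _ , _ , refl , refl , refl , t₀) (_ , _ , _ , refl , refl , refl , t₁) (x≢y ∘ einj e) (nonEdge-emb e x≁y)
  certificate-witnessed (edge tab _ _ _ _) refl =
    edge (_ , _ , _ , refl , refl , refl , tab) (Edge-irrefl G (proj₂ (proj₂ tab)) ∘ einj e)

  module _ (_≟_ : DecidableEquality A) (bowtieFree : BowtieFree G) where
    open BowtieFreeGraph _≟_ G bowtieFree

    through-meet : ∀ {v a b c d} → Through v a b → Through v c d → Meets a b c d
    through-meet (w , x , y , refl , refl , refl , t) (w′ , x′ , y′ , ew′ , refl , refl , t′)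
      with einj e ew′
    ... | refl with triangles-meet t t′
    ... | inj₁ (inj₁ refl) = inj₁ (inj₁ refl)
    ... | inj₁ (inj₂ refl) = inj₁ (inj₂ refl)
    ... | inj₂ (inj₁ refl) = inj₂ (inj₁ refl)
    ... | inj₂ (inj₂ refl) = inj₂ (inj₂ refl)

    through-bounded : ∀ {w σ v} → Certificate G w σ → emb e w ≡ v → Through v ⊑ mapShape (emb e) σ
    through-bounded {σ = σ} c refl (w′ , x , y , ew′ , refl , refl , t) with einj e ew′
    ... | refl = admits-map (emb e) σ (certificate-bound c t)

-- Iterating a partial map

module Iterate {A : Set} (g : A → Maybe A) where

  iterate : ℕ → A → Maybe A
  iterate zero    x = just x
  iterate (suc k) x = g x >>= iterate k

  iterate-+ : ∀ a b x → iterate (a + b) x ≡ (iterate a x >>= iterate b)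
  iterate-+ zero    b x = refl
  iterate-+ (suc a) b x with g x
  ... | nothing = refl
  ... | just y  = iterate-+ a b y

  iterate-+-just : ∀ a b {x y} → iterate a x ≡ just y → iterate (a + b) x ≡ iterate b y
  iterate-+-just a b {x} e = trans (iterate-+ a b x) (cong (_>>= iterate b) e)

  iterate-suc : ∀ k x → iterate (suc k) x ≡ (iterate k x >>= g)
  iterate-suc k x = trans (cong (λ m → iterate m x) (+-comm 1 k)) (trans (iterate-+ k 1 x) (bind-g (iterate k x)))
    where
    bind-g : ∀ m → (m >>= iterate 1) ≡ (m >>= g)
    bind-g nothing = refl
    bind-g (just y) with g y
    ... | nothing = refl
    ... | just _  = refl

  iterate-prefix : ∀ a b {x y} → iterate (a + b) x ≡ just y → ∃ λ z → iterate a x ≡ just z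
  iterate-prefix a b {x} e with iterate a x | iterate-+ a b x
  ... | just z  | _  = z , refl
  ... | nothing | e′ with trans (sym e′) e
  ... | ()

  iterate-first : ∀ d {s x} → iterate (suc d) s ≡ just x → ∃ λ y → g s ≡ just y × iterate d y ≡ just x
  iterate-first d {s} e with g s
  ... | just y = y , refl , e

  iterate-last : ∀ d {s x} → iterate (suc d) s ≡ just x → ∃ λ y → iterate d s ≡ just y × g y ≡ just x
  iterate-last d {s} e with iterate d s | iterate-suc d s
  ... | just y  | e′ = y , refl , trans (sym e′) e
  ... | nothing | e′ with trans (sym e′) e
  ... | ()

  iterate-* : ∀ q L {x} → iterate L x ≡ just x → iterate (q * L) x ≡ just x
  iterate-* zero    L e = refl
  iterate-* (suc q) L e = trans (iterate-+-just L (q * L) e) (iterate-* q L e)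

  module _ (g-injective : ∀ {x x′ y} → g x ≡ just y → g x′ ≡ just y → x ≡ x′) where

    iterate-injective : ∀ k {x x′ y} → iterate k x ≡ just y → iterate k x′ ≡ just y → x ≡ x′
    iterate-injective zero refl refl = refl
    iterate-injective (suc k) {x} {x′} e e′ with iterate-first k e | iterate-first k e′
    ... | z , gx , e₁ | z′ , gx′ , e₁′ with iterate-injective k e₁ e₁′
    ... | refl = g-injective gx gx′

module _ {n : ℕ} (g : Fin n → Maybe (Fin n)) where
  open Iterate g

  -- pigeonhole: n steps revisit some vertex, and the loop between the two visits carries over to the end
  iterate-returns : ∀ {y x} → iterate n y ≡ just x → ∃ λ L → 1 ≤ L × L ≤ n × iterate L x ≡ just x
  iterate-returns {y} {x} e = L , m<n⇒0<n∸m i<j , L≤n , returns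
    where
    visit : (i : Fin (suc n)) → ∃ λ z → iterate (toℕ i) y ≡ just z
    visit i = iterate-prefix (toℕ i) (n ∸ toℕ i)
      (trans (cong (λ m → iterate m y) (m+[n∸m]≡n (s≤s⁻¹ (toℕ<n i)))) e)
    collision = pigeonhole (n<1+n n) (proj₁ ∘ visit)
    i = proj₁ collision
    j = proj₁ (proj₂ collision)
    i<j = proj₁ (proj₂ (proj₂ collision))
    z = proj₁ (visit i)
    L = toℕ j ∸ toℕ i
    M = n ∸ toℕ i
    L≤n : L ≤ n
    L≤n = ≤-trans (m∸n≤m (toℕ j) (toℕ i)) (s≤s⁻¹ (toℕ<n j))
    z-loop : iterate L z ≡ just z
    z-loop = trans (sym (iterate-+-just (toℕ i) L (proj₂ (visit i))))
      (trans (cong (λ m → iterate m y) (m+[n∸m]≡n (<⇒≤ i<j)))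
      (trans (proj₂ (visit j)) (cong just (sym (proj₂ (proj₂ (proj₂ collision)))))))
    z-to-x : iterate M z ≡ just x
    z-to-x = trans (sym (iterate-+-just (toℕ i) M (proj₂ (visit i))))
      (trans (cong (λ m → iterate m y) (m+[n∸m]≡n (s≤s⁻¹ (toℕ<n i)))) e)
    returns : iterate L x ≡ just x
    returns = trans (sym (iterate-+-just M L z-to-x))
      (trans (cong (λ m → iterate m z) (+-comm M L)) (trans (iterate-+-just L M z-loop) z-to-x))

-- Residues and short arcs on a cycle

module Modular (N′ : ℕ) where

  N : ℕ
  N = suc N′

  infix 4 _≈_
  record _≈_ (x y : ℕ) : Set where
    constructor mod≈
    field ≈⇒% : x % N ≡ y % N
  open _≈_ public

  ≈-refl : ∀ {x} → x ≈ x
  ≈-refl = mod≈ refl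

  ≈-reflexive : ∀ {x y} → x ≡ y → x ≈ y
  ≈-reflexive refl = ≈-refl

  ≈-sym : ∀ {x y} → x ≈ y → y ≈ x
  ≈-sym (mod≈ e) = mod≈ (sym e)

  ≈-trans : ∀ {x y z} → x ≈ y → y ≈ z → x ≈ z
  ≈-trans (mod≈ e) (mod≈ e′) = mod≈ (trans e e′)

  %-≈ : ∀ x → x % N ≈ x
  %-≈ x = mod≈ (m%n%n≡m%n x N)

  +N-≈ : ∀ x → x + N ≈ x
  +N-≈ x = mod≈ ([m+n]%n≡m%n x N)

  +-congʳ-≈ : ∀ {x y} k → x ≈ y → x + k ≈ y + k
  +-congʳ-≈ {x} {y} k (mod≈ e) = mod≈ (begin
    (x + k) % N             ≡⟨ %-distribˡ-+ x k N ⟩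
    (x % N + k % N) % N     ≡⟨ cong (λ z → (z + k % N) % N) e ⟩
    (y % N + k % N) % N     ≡⟨ %-distribˡ-+ y k N ⟨
    (y + k) % N             ∎)
    where open ≡-Reasoning

  +-cancelʳ-≈ : ∀ {x y} k → x + k ≈ y + k → x ≈ y
  +-cancelʳ-≈ {x} {y} k e = mod≈ (begin
    x % N                   ≡⟨ [m+kn]%n≡m%n x k N ⟨
    (x + k * N) % N         ≡⟨ ≈⇒% (shifted x) ⟩
    (x + k + k′) % N        ≡⟨ ≈⇒% (+-congʳ-≈ k′ e) ⟩
    (y + k + k′) % N        ≡⟨ ≈⇒% (shifted y) ⟨
    (y + k * N) % N         ≡⟨ [m+kn]%n≡m%n y k N ⟩
    y % N                   ∎)
    where
    open ≡-Reasoning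
    k′ : ℕ
    k′ = k * N ∸ k
    shifted : ∀ z → z + k * N ≈ z + k + k′
    shifted z = ≈-reflexive (trans (cong (z +_) (sym (m+[n∸m]≡n (m≤m*n k N)))) (sym (+-assoc z k k′)))

  +-cancelˡ-≈ : ∀ {x y} k → x < N → y < N → k + x ≈ k + y → x ≡ y
  +-cancelˡ-≈ {x} {y} k x<N y<N e = begin
    x       ≡⟨ m<n⇒m%n≡m x<N ⟨
    x % N   ≡⟨ ≈⇒% (+-cancelʳ-≈ k (≈-trans (≈-reflexive (+-comm x k)) (≈-trans e (≈-reflexive (+-comm k y))))) ⟩
    y % N   ≡⟨ m<n⇒m%n≡m y<N ⟩
    y       ∎
    where open ≡-Reasoning

  catch-up : ∀ t t′ → ∃ λ m → t′ + m ≈ t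
  catch-up t t′ = N ∸ r + t , ≈-trans (≈-reflexive eq) (mod≈ ([m+kn]%n≡m%n t (suc (t′ / N)) N))
    where
    r = t′ % N
    q = t′ / N
    eq : t′ + (N ∸ r + t) ≡ t + suc q * N
    eq = begin
      t′ + (N ∸ r + t)              ≡⟨ cong (_+ (N ∸ r + t)) (trans (m≡m%n+[m/n]*n t′ N) (+-comm r (q * N))) ⟩
      q * N + r + (N ∸ r + t)       ≡⟨ +-assoc (q * N) r (N ∸ r + t) ⟩
      q * N + (r + (N ∸ r + t))     ≡⟨ cong (q * N +_) (sym (+-assoc r (N ∸ r) t)) ⟩
      q * N + (r + (N ∸ r) + t)     ≡⟨ cong (λ z → q * N + (z + t)) (m+[n∸m]≡n (<⇒≤ (m%n<n t′ N))) ⟩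
      q * N + (N + t)               ≡⟨ solve-catch-up (q * N) N t ⟩
      t + suc q * N                 ∎
      where
      open ≡-Reasoning
      solve-catch-up : ∀ a b c → a + (b + c) ≡ c + (b + a)
      solve-catch-up a b c = trans (+-comm a (b + c)) (trans (+-assoc b c a) (trans (+-comm b (c + a))
        (trans (+-assoc c a b) (cong (c +_) (+-comm a b)))))

module ArcHelly (N′ n : ℕ) (3n<N : 3 * n < suc N′) where
  open Modular N′

  -- copy t contains the vertex lying at depth d₁ of its p-chain in copy t₁ (and at depth d₂ in another copy)
  Visible : ℕ → ℕ → ℕ → ℕ → Set
  Visible t t₁ d₁ d₂ = ∃ λ δ → t + δ ≈ t₁ + d₁ × (δ ≤ d₁ ⊎ δ ≤ d₂)

  private
    offset : ∀ {t t′ e d} → t + (e + d) ≈ t′ + e → t + d ≈ t′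
    offset {t} {t′} {e} {d} h =
      +-cancelʳ-≈ e (≈-trans (≈-reflexive (swap t d e)) h)
      where
      swap : ∀ a b c → a + b + c ≡ a + (c + b)
      swap = solve-∀

    regroup : ∀ {t t′ d} e → t + d ≈ t′ → t + (d + e) ≈ t′ + e
    regroup {t} {t′} {d} e h = ≈-trans (≈-reflexive (sym (+-assoc t d e))) (+-congʳ-≈ e h)

    sum<N : ∀ {a b c} → a ≤ n → b ≤ n → c ≤ n → a + b + c < N
    sum<N a≤n b≤n c≤n = ≤-<-trans (+-mono-≤ (+-mono-≤ a≤n b≤n) c≤n) (subst (_< N) (three n) 3n<N)
      where
      three : ∀ n → 3 * n ≡ n + n + n
      three = solve-∀

  -- going around the triangle of copies i → j → k → i returns to the same residue; the depths are
  -- too small for a wrap-around, so the identity holds in ℕ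
  balance : ∀ {i j k α₁ α₃ β₁ β₂ γ₂ γ₃} → α₁ ≤ n → α₃ ≤ n → β₁ ≤ n → β₂ ≤ n → γ₂ ≤ n → γ₃ ≤ n →
            i + α₁ ≈ k + α₃ → i + β₁ ≈ j + β₂ → j + γ₂ ≈ k + γ₃ → β₁ + γ₂ + α₃ ≡ α₁ + γ₃ + β₂
  balance {i} {j} {k} {α₁} {α₃} {β₁} {β₂} {γ₂} {γ₃} α₁≤ α₃≤ β₁≤ β₂≤ γ₂≤ γ₃≤ ha hb hc =
    +-cancelˡ-≈ i (sum<N β₁≤ γ₂≤ α₃≤) (sum<N α₁≤ γ₃≤ β₂≤)
      (≈-trans (≈-reflexive (r₁ i β₁ γ₂ α₃)) (≈-trans (+-congʳ-≈ (γ₂ + α₃) hb)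
      (≈-trans (≈-reflexive (r₂ j β₂ γ₂ α₃)) (≈-trans (+-congʳ-≈ (β₂ + α₃) hc)
      (≈-trans (≈-reflexive (r₃ k γ₃ β₂ α₃)) (≈-trans (+-congʳ-≈ (γ₃ + β₂) (≈-sym ha))
      (≈-reflexive (r₄ i α₁ γ₃ β₂))))))))
    where
    r₁ : ∀ i β₁ γ₂ α₃ → i + (β₁ + γ₂ + α₃) ≡ i + β₁ + (γ₂ + α₃)
    r₁ = solve-∀
    r₂ : ∀ j β₂ γ₂ α₃ → j + β₂ + (γ₂ + α₃) ≡ j + γ₂ + (β₂ + α₃)
    r₂ = solve-∀
    r₃ : ∀ k γ₃ β₂ α₃ → k + γ₃ + (β₂ + α₃) ≡ k + α₃ + (γ₃ + β₂)
    r₃ = solve-∀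
    r₄ : ∀ i α₁ γ₃ β₂ → i + α₁ + (γ₃ + β₂) ≡ i + (α₁ + γ₃ + β₂)
    r₄ = solve-∀

  private
    shifted : ∀ {t t′ d} a b → t + d ≈ t′ → t′ + (a + b) ≈ t + (a + (d + b))
    shifted {t} {t′} {d} a b h =
      ≈-trans (+-congʳ-≈ (a + b) (≈-sym h)) (≈-reflexive (r t d a b))
      where
      r : ∀ t d a b → t + d + (a + b) ≡ t + (a + (d + b))
      r = solve-∀

    visible-via-j : ∀ {i j β₂ γ₂ γ₃ α₁} D K → β₂ + D + γ₂ + (α₁ + K) ≡ α₁ + γ₃ + β₂ →
                    i + (β₂ + D) ≈ j + β₂ → Visible i j γ₂ γ₃
    visible-via-j {i} {j} {β₂ = β₂} {γ₂} {γ₃} {α₁} D K bal hb =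
      D + γ₂ , regroup {i} {j} {D} γ₂ (offset {i} {j} {β₂} {D} hb) ,
      inj₂ (subst (D + γ₂ ≤_) γ₃≡ (m≤m+n (D + γ₂) K))
      where
      r₁ : ∀ α₁ β₂ D γ₂ K → α₁ + β₂ + (D + γ₂ + K) ≡ β₂ + D + γ₂ + (α₁ + K)
      r₁ = solve-∀
      r₂ : ∀ α₁ γ₃ β₂ → α₁ + γ₃ + β₂ ≡ α₁ + β₂ + γ₃
      r₂ = solve-∀
      γ₃≡ : D + γ₂ + K ≡ γ₃
      γ₃≡ = +-cancelˡ-≡ (α₁ + β₂) _ _ (trans (r₁ α₁ β₂ D γ₂ K) (trans bal (r₂ α₁ γ₃ β₂)))

    visible-via-k : ∀ {i j k β₁ γ₂ γ₃ α₃} J K → β₁ + γ₂ + α₃ ≡ α₃ + K + γ₃ + (β₁ + J) →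
                    i + (α₃ + K) ≈ k + α₃ → j + γ₂ ≈ k + γ₃ → Visible i j γ₂ γ₃
    visible-via-k {i} {j} {k} {β₁} {γ₂} {γ₃} {α₃} J K bal ha hc =
      K + γ₃ , ≈-trans (regroup {i} {k} {K} γ₃ (offset {i} {k} {α₃} {K} ha)) (≈-sym hc) ,
      inj₁ (subst (K + γ₃ ≤_) (sym γ₂≡) (m≤m+n (K + γ₃) J))
      where
      r₁ : ∀ β₁ α₃ γ₂ → β₁ + α₃ + γ₂ ≡ β₁ + γ₂ + α₃
      r₁ = solve-∀
      r₂ : ∀ α₃ K γ₃ β₁ J → α₃ + K + γ₃ + (β₁ + J) ≡ β₁ + α₃ + (K + γ₃ + J)
      r₂ = solve-∀
      γ₂≡ : γ₂ ≡ K + γ₃ + J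
      γ₂≡ = +-cancelˡ-≡ (β₁ + α₃) _ _ (trans (r₁ β₁ α₃ γ₂) (trans bal (r₂ α₃ K γ₃ β₁ J)))

    carry : ∀ {t t′ a d} → t + (a + d) ≈ t′ + a → ∀ e → t + (e + d) ≈ t′ + e
    carry {t} {t′} {a} {d} h e =
      ≈-trans (≈-reflexive (cong (t +_) (+-comm e d))) (regroup {t} {t′} {d} e (offset {t} {t′} {a} {d} h))

    a-or-b-visible : ∀ {i j k α₃ β₂} D K → i + (α₃ + K) ≈ k + α₃ → i + (β₂ + D) ≈ j + β₂ →
                     Visible j i (α₃ + K) α₃ ⊎ Visible k i (β₂ + D) β₂
    a-or-b-visible {i} {j} {k} {α₃} {β₂} D K ha hb with ≤-total D K
    ... | inj₁ D≤K with m≤n⇒∃[o]m+o≡n D≤K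
    ...   | R , refl =
      inj₁ (α₃ + R , shifted {i} {j} {D} α₃ R (offset {i} {j} {β₂} {D} hb) , inj₁ (+-monoʳ-≤ α₃ (m≤n+m R D)))
    a-or-b-visible {i} {j} {k} {α₃} {β₂} D K ha hb | inj₂ K≤D with m≤n⇒∃[o]m+o≡n K≤D
    ...   | R , refl =
      inj₂ (β₂ + R , shifted {i} {k} {K} β₂ R (offset {i} {k} {α₃} {K} ha) , inj₁ (+-monoʳ-≤ β₂ (m≤n+m R K)))

    a-or-b-visible′ : ∀ {i j k α₁ β₁} J K → i + α₁ ≈ k + (α₁ + K) → i + β₁ ≈ j + (β₁ + J) →
                      Visible j i α₁ (α₁ + K) ⊎ Visible k i β₁ (β₁ + J)
    a-or-b-visible′ {i} {j} {k} {α₁} {β₁} J K ha hb with ≤-total J K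
    ... | inj₁ J≤K with m≤n⇒∃[o]m+o≡n J≤K
    ...   | R , refl = inj₁ (α₁ + J , carry {j} {i} {β₁} {J} (≈-sym hb) α₁ , inj₂ (+-monoʳ-≤ α₁ (m≤m+n J R)))
    a-or-b-visible′ {i} {j} {k} {α₁} {β₁} J K ha hb | inj₂ K≤J with m≤n⇒∃[o]m+o≡n K≤J
    ...   | R , refl = inj₂ (β₁ + K , carry {k} {i} {α₁} {K} (≈-sym ha) β₁ , inj₂ (+-monoʳ-≤ β₁ (m≤m+n K R)))

  arc-helly : ∀ {i j k α₁ α₃ β₁ β₂ γ₂ γ₃} → α₁ ≤ n → α₃ ≤ n → β₁ ≤ n → β₂ ≤ n → γ₂ ≤ n → γ₃ ≤ n →
              i + α₁ ≈ k + α₃ → i + β₁ ≈ j + β₂ → j + γ₂ ≈ k + γ₃ →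
              Visible i j γ₂ γ₃ ⊎ Visible j i α₁ α₃ ⊎ Visible k i β₁ β₂
  arc-helly {α₁ = α₁} {α₃} {β₁} {β₂} α₁≤ α₃≤ β₁≤ β₂≤ γ₂≤ γ₃≤ ha hb hc
    with balance α₁≤ α₃≤ β₁≤ β₂≤ γ₂≤ γ₃≤ ha hb hc | ≤-total β₂ β₁ | ≤-total α₁ α₃
  ... | bal | inj₁ β₂≤β₁ | inj₁ α₁≤α₃ with m≤n⇒∃[o]m+o≡n β₂≤β₁ | m≤n⇒∃[o]m+o≡n α₁≤α₃
  ...   | D , refl | K , refl = inj₁ (visible-via-j D K bal hb)
  arc-helly _ _ _ _ _ _ ha hb hc | bal | inj₂ β₁≤β₂ | inj₂ α₃≤α₁
    with m≤n⇒∃[o]m+o≡n β₁≤β₂ | m≤n⇒∃[o]m+o≡n α₃≤α₁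
  ... | J , refl | K , refl = inj₁ (visible-via-k J K bal ha hc)
  arc-helly {i} {j} {k} _ _ _ _ _ _ ha hb hc | _ | inj₁ β₂≤β₁ | inj₂ α₃≤α₁
    with m≤n⇒∃[o]m+o≡n β₂≤β₁ | m≤n⇒∃[o]m+o≡n α₃≤α₁
  ... | D , refl | K , refl = inj₂ (a-or-b-visible {i} {j} {k} D K ha hb)
  arc-helly {i} {j} {k} _ _ _ _ _ _ ha hb hc | _ | inj₂ β₁≤β₂ | inj₁ α₁≤α₃
    with m≤n⇒∃[o]m+o≡n β₁≤β₂ | m≤n⇒∃[o]m+o≡n α₁≤α₃
  ... | J , refl | K , refl = inj₂ (a-or-b-visible′ {i} {j} {k} J K ha hb)

-- The orbit graph

module Orbits (n : ℕ) (G : Graph (Fin n)) (U W : Subset n) (p : Iso (Induced G U) (Induced G W)) where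

  step : Fin n → Maybe (Fin n)
  step x with T? (U x)
  ... | yes x∈U = just (proj₁ (isoMap p (x , x∈U)))
  ... | no _    = nothing

  step-def : ∀ x (x∈U : T (U x)) → step x ≡ just (proj₁ (isoMap p (x , x∈U)))
  step-def x x∈U with T? (U x)
  ... | yes x∈U′ = cong (λ h → just (proj₁ (isoMap p (x , h)))) (T-irrelevant x∈U′ x∈U)
  ... | no x∉U   = contradiction x∈U x∉U

  step-domain : ∀ {x y} → step x ≡ just y → Σ (T (U x)) λ x∈U → proj₁ (isoMap p (x , x∈U)) ≡ y
  step-domain {x} e with T? (U x)
  step-domain refl | yes x∈U = x∈U , refl

  step-injective : ∀ {x x′ y} → step x ≡ just y → step x′ ≡ just y → x ≡ x′
  step-injective e e′ with step-domain e | step-domain e′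
  ... | _ , q | _ , q′ = cong proj₁ (Bijection.injective (bij p) (einj (inclusion G W) (trans q (sym q′))))

  step-W : ∀ {x y} → step x ≡ just y → T (W y)
  step-W {x} e with step-domain e
  ... | x∈U , refl = proj₂ (isoMap p (x , x∈U))

  step-onto : ∀ {y} → T (W y) → ∃ λ x → step x ≡ just y
  step-onto {y} y∈W with Bijection.surjective (bij p) (y , y∈W)
  ... | (x , x∈U) , onto = x , trans (step-def x x∈U) (cong (just ∘ proj₁) (onto refl))

  step-adj : ∀ {x x′ y y′} → step x ≡ just x′ → step y ≡ just y′ → adj G x′ y′ ≡ adj G x y
  step-adj {x} {y = y} e e′ with step-domain e | step-domain e′
  ... | x∈U , refl | y∈U , refl = pres p (x , x∈U) (y , y∈U)

  open Iterate step public

  iterate-adj : ∀ k {x x′ y y′} → iterate k x ≡ just x′ → iterate k y ≡ just y′ → adj G x′ y′ ≡ adj G x y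
  iterate-adj zero refl refl = refl
  iterate-adj (suc k) e e′ with iterate-first k e | iterate-first k e′
  ... | _ , sx , e₁ | _ , sy , e₁′ = trans (iterate-adj k e₁ e₁′) (step-adj sx sy)

  iterate-injective′ : ∀ k {x x′ y} → iterate k x ≡ just y → iterate k x′ ≡ just y → x ≡ x′
  iterate-injective′ = iterate-injective step-injective

  -- N = (3n+1)! is a multiple of every cycle length of p and exceeds 3n (see arc-helly)
  period′ : ℕ
  period′ = pred (suc (3 * n) !)

  open Modular period′ public

  N≡[1+3n]! : N ≡ suc (3 * n) !
  N≡[1+3n]! = suc-pred (suc (3 * n) !) {{suc (3 * n) !≢0}}

  3n<N : 3 * n < N
  3n<N = subst (3 * n <_) (sym N≡[1+3n]!) (m≤m*n (suc (3 * n)) ((3 * n) !) {{(3 * n) !≢0}})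

  Cyclic : Fin n → Set
  Cyclic x = iterate N x ≡ just x

  cyclic? : ∀ x → Dec (Cyclic x)
  cyclic? x with iterate N x
  ... | nothing = no λ ()
  ... | just y with y ≟ᶠ x
  ...   | yes refl = yes refl
  ...   | no y≢x   = no (y≢x ∘ just-injective)

  loop⇒cyclic : ∀ {L x} → 1 ≤ L → L ≤ n → iterate L x ≡ just x → Cyclic x
  loop⇒cyclic {suc L} {x} _ L≤n loop
    with ∣-trans (m∣m*n {suc L} (L !)) (m≤n⇒m!∣n! (≤-trans L≤n (≤-trans (m≤m+n n (2 * n)) (n≤1+n (3 * n)))))
  ... | divides q N≡q*L = trans (cong (λ k → iterate k x) (trans N≡[1+3n]! N≡q*L)) (iterate-* q (suc L) loop)

  Chain : Fin n → Set
  Chain x = Σ (Fin n) λ s → Σ ℕ λ d → d ≤ n × ¬ T (W s) × iterate d s ≡ just x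

  private
    trace-back : ∀ k x → (Σ (Fin n) λ s → Σ ℕ λ d → d ≤ k × ¬ T (W s) × iterate d s ≡ just x)
                       ⊎ (∃ λ y → iterate k y ≡ just x)
    trace-back zero x = inj₂ (x , refl)
    trace-back (suc k) x with T? (W x)
    ... | no x∉W = inj₁ (x , 0 , z≤n , x∉W , refl)
    ... | yes x∈W with step-onto x∈W
    ... | x₁ , e with trace-back k x₁
    ... | inj₁ (s , d , d≤k , s∉W , es) =
      inj₁ (s , suc d , s≤s d≤k , s∉W , trans (iterate-suc d s) (trans (cong (_>>= step) es) e))
    ... | inj₂ (y , ey) = inj₂ (y , trans (iterate-suc k y) (trans (cong (_>>= step) ey) e))

  chain : ∀ x → ¬ Cyclic x → Chain x
  chain x ¬cyclic with trace-back n x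
  ... | inj₁ c = c
  ... | inj₂ (y , e) with iterate-returns step e
  ... | L , 1≤L , L≤n , loop = ⊥-elim (¬cyclic (loop⇒cyclic 1≤L L≤n loop))

  chain-unique : ∀ d d′ {s s′ x} → ¬ T (W s) → ¬ T (W s′) → iterate d s ≡ just x → iterate d′ s′ ≡ just x →
                 d ≡ d′ × s ≡ s′
  chain-unique zero zero _ _ refl refl = refl , refl
  chain-unique zero (suc d′) s∉W _ refl e′ with iterate-last d′ e′
  ... | _ , _ , e = ⊥-elim (s∉W (step-W e))
  chain-unique (suc d) zero _ s′∉W e refl with iterate-last d e
  ... | _ , _ , e′ = ⊥-elim (s′∉W (step-W e′))
  chain-unique (suc d) (suc d′) s∉W s′∉W e e′ with iterate-last d e | iterate-last d′ e′
  ... | y , q , ey | y′ , q′ , ey′ with step-injective ey ey′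
  ... | refl with chain-unique d d′ s∉W s′∉W q q′
  ... | refl , refl = refl , refl

  cyclic-step : ∀ {y} → Cyclic y → ∃ λ z → step y ≡ just z × Cyclic z
  cyclic-step {y} c with iterate-first period′ c
  ... | z , ez , q = z , ez , trans (iterate-suc period′ z) (trans (cong (_>>= step) q) ez)

  cyclic-pred : ∀ {u y} → step u ≡ just y → Cyclic y → Cyclic u
  cyclic-pred {u} e c with iterate-last N {u} (trans (cong (_>>= iterate N) e) c)
  ... | w , qw , ew with step-injective ew e
  ... | refl = qw

  cyclic-succ : ∀ {u y} → step u ≡ just y → Cyclic u → Cyclic y
  cyclic-succ e c with cyclic-step c
  ... | z , ez , cz with trans (sym e) ez
  ... | refl = cz

  cyclic-W : ∀ {y} → Cyclic y → T (W y)
  cyclic-W c with iterate-last period′ c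
  ... | _ , _ , e = step-W e

  cyclic-iterate : ∀ {x} → Cyclic x → ∀ k → ∃ λ z → iterate k x ≡ just z × Cyclic z
  cyclic-iterate c zero = _ , refl , c
  cyclic-iterate c (suc k) with cyclic-step c
  ... | z , ez , cz with cyclic-iterate cz k
  ... | w , ew , cw = w , trans (cong (_>>= iterate k) ez) ew , cw

  cyclic-iterate-% : ∀ {x} → Cyclic x → ∀ k → iterate (k % N) x ≡ iterate k x
  cyclic-iterate-% {x} c k with cyclic-iterate c (k % N)
  ... | z , ez , cz = sym (begin
    iterate k x                         ≡⟨ cong (λ m → iterate m x) (m≡m%n+[m/n]*n k N) ⟩
    iterate (k % N + (k / N) * N) x     ≡⟨ iterate-+-just (k % N) ((k / N) * N) ez ⟩
    iterate ((k / N) * N) z             ≡⟨ iterate-* (k / N) N cz ⟩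
    just z                              ≡⟨ ez ⟨
    iterate (k % N) x                   ∎)
    where open ≡-Reasoning

  cyclic-pred* : ∀ m {u y} → iterate m u ≡ just y → Cyclic y → Cyclic u
  cyclic-pred* zero refl c = c
  cyclic-pred* (suc m) e c with iterate-first m e
  ... | _ , e₁ , e′ = cyclic-pred e₁ (cyclic-pred* m e′ c)

  -- A vertex of K on a p-chain is named by the start s ∉ W of the chain and the time c of the copy
  -- of s it is glued to; a vertex on a p-cycle by the vertex itself in copy 0.
  canonical : Fin n × Fin N → Bool
  canonical (y , zero)  = not (W y) ∨ does (cyclic? y)
  canonical (y , suc _) = not (W y)

  V : Set
  V = Σ (Fin n × Fin N) (T ∘ canonical)

  vertex-≡ : ∀ {y y′ c c′} {h : T (canonical (y , c))} {h′ : T (canonical (y′ , c′))} →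
             y ≡ y′ → c ≡ c′ → _≡_ {A = V} ((y , c) , h) ((y′ , c′) , h′)
  vertex-≡ {h = h} {h′} refl refl = cong (_ ,_) (T-irrelevant h h′)

  chainVertex : (s : Fin n) → ¬ T (W s) → ℕ → V
  chainVertex s s∉W c = (s , c mod N) , start (c mod N)
    where
    s∉W′ : T (not (W s))
    s∉W′ with W s
    ... | false = tt
    ... | true  = s∉W tt
    start : ∀ c → T (canonical (s , c))
    start zero    = Equivalence.from T-∨ (inj₁ s∉W′)
    start (suc _) = s∉W′

  cycleVertex : (y : Fin n) → Cyclic y → V
  cycleVertex y c = (y , zero) , Equivalence.from T-∨ (inj₂ (decided (cyclic? y)))
    where
    decided : (c? : Dec (Cyclic y)) → T (does c?)
    decided (yes _) = tt
    decided (no ¬c) = ¬c c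

  toℕ-mod : ∀ c → toℕ (c mod N) ≡ c % N
  toℕ-mod c = toℕ-fromℕ< (m%n<n c N)

  chainVertex-cong : ∀ {s c c′} {s∉W s∉W′ : ¬ T (W s)} → c ≈ c′ → chainVertex s s∉W c ≡ chainVertex s s∉W′ c′
  chainVertex-cong {c = c} {c′} (mod≈ e) =
    vertex-≡ refl (toℕ-injective (trans (toℕ-mod c) (trans e (sym (toℕ-mod c′)))))

  chainVertex-injective : ∀ {s s′ c c′} {s∉W : ¬ T (W s)} {s′∉W : ¬ T (W s′)} →
                          chainVertex s s∉W c ≡ chainVertex s′ s′∉W c′ → s ≡ s′ × c ≈ c′
  chainVertex-injective {c = c} {c′} e = cong (proj₁ ∘ proj₁) e ,
    mod≈ (trans (sym (toℕ-mod c)) (trans (cong (toℕ ∘ proj₂ ∘ proj₁) e) (toℕ-mod c′)))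

  cycleVertex-cong : ∀ {y y′} {c : Cyclic y} {c′ : Cyclic y′} → y ≡ y′ → cycleVertex y c ≡ cycleVertex y′ c′
  cycleVertex-cong refl = vertex-≡ refl refl

  cycleVertex-injective : ∀ {y y′} {c : Cyclic y} {c′ : Cyclic y′} → cycleVertex y c ≡ cycleVertex y′ c′ → y ≡ y′
  cycleVertex-injective = cong (proj₁ ∘ proj₁)

  cycleVertex≢chainVertex : ∀ {y s c′} {c : Cyclic y} {s∉W : ¬ T (W s)} → cycleVertex y c ≢ chainVertex s s∉W c′
  cycleVertex≢chainVertex {c = c} {s∉W} e with cong (proj₁ ∘ proj₁) e
  ... | refl = s∉W (cyclic-W c)

  data Orbit (x : Fin n) : Set where
    cyclic : Cyclic x → Orbit x
    chained : ¬ Cyclic x → (s : Fin n) (d : ℕ) → d ≤ n → (s∉W : ¬ T (W s)) → iterate d s ≡ just x → Orbit x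

  orbit : ∀ x → Orbit x
  orbit x with cyclic? x
  ... | yes c = cyclic c
  ... | no ¬c with chain x ¬c
  ... | s , d , d≤n , s∉W , e = chained ¬c s d d≤n s∉W e

  -- the vertex x of the copy at time t
  ψ : ℕ → Fin n → V
  ψ t x with cyclic? x
  ... | yes c = cycleVertex _ (proj₂ (proj₂ (cyclic-iterate c (t % N))))
  ... | no ¬c with chain x ¬c
  ... | s , d , _ , s∉W , _ = chainVertex s s∉W (t + d)

  ψ-cyclic : ∀ {x} → Cyclic x → ∀ t {z} → iterate (t % N) x ≡ just z → (cz : Cyclic z) → ψ t x ≡ cycleVertex z cz
  ψ-cyclic {x} c t e cz with cyclic? x
  ... | no ¬c = ⊥-elim (¬c c)
  ... | yes c′ = cycleVertex-cong (just-injective (trans (sym (proj₁ (proj₂ (cyclic-iterate c′ (t % N))))) e))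

  ψ-cyclic′ : ∀ {x} → Cyclic x → ∀ t →
              ∃ λ z → Σ (Cyclic z) λ cz → iterate (t % N) x ≡ just z × ψ t x ≡ cycleVertex z cz
  ψ-cyclic′ c t with cyclic-iterate c (t % N)
  ... | z , ez , cz = z , cz , ez , ψ-cyclic c t ez cz

  ψ-chain : ∀ {x} → ¬ Cyclic x → ∀ t {s d} (s∉W : ¬ T (W s)) → iterate d s ≡ just x →
            ψ t x ≡ chainVertex s s∉W (t + d)
  ψ-chain {x} ¬c t {d = d} s∉W e with cyclic? x
  ... | yes c = ⊥-elim (¬c c)
  ... | no ¬c′ with chain x ¬c′
  ... | s′ , d′ , _ , s′∉W , e′ with chain-unique d′ d s′∉W s∉W e′ e
  ... | refl , refl = refl

  ψ-≈ : ∀ {t t′} → t ≈ t′ → ∀ x → ψ t x ≡ ψ t′ x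
  ψ-≈ {t} {t′} t≈t′ x with orbit x
  ... | cyclic c with ψ-cyclic′ c t
  ... | z , cz , ez , q = trans q (sym (ψ-cyclic c t′ (trans (cong (λ k → iterate k x) (sym (≈⇒% t≈t′))) ez) cz))
  ψ-≈ {t} {t′} t≈t′ x | chained ¬c s d _ s∉W e =
    trans (ψ-chain ¬c t s∉W e) (trans (chainVertex-cong (+-congʳ-≈ d t≈t′)) (sym (ψ-chain ¬c t′ s∉W e)))

  ψ-step : ∀ {u y} t → step u ≡ just y → ψ (suc t) u ≡ ψ t y
  ψ-step {u} {y} t e with orbit y
  ... | cyclic cy with ψ-cyclic′ cy t
  ... | z , cz , ez , q = trans (ψ-cyclic (cyclic-pred e cy) (suc t) u-to-z cz) (sym q)
    where
    u-to-z : iterate (suc t % N) u ≡ just z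
    u-to-z = trans (cyclic-iterate-% (cyclic-pred e cy) (suc t))
      (trans (cong (_>>= iterate t) e) (trans (sym (cyclic-iterate-% cy t)) ez))
  ψ-step {u} {y} t e | chained ¬cy s d _ s∉W ey with orbit u
  ... | cyclic cu = ⊥-elim (¬cy (cyclic-succ e cu))
  ... | chained ¬cu s′ d′ _ s′∉W eu = begin
    ψ (suc t) u                          ≡⟨ ψ-chain ¬cu (suc t) s′∉W eu ⟩
    chainVertex s′ s′∉W (suc t + d′)     ≡⟨ chainVertex-cong (≈-reflexive (sym (+-suc t d′))) ⟩
    chainVertex s′ s′∉W (t + suc d′)     ≡⟨ ψ-chain ¬cy t s′∉W s′-to-y ⟨
    ψ t y                                ∎
    where
    open ≡-Reasoning
    s′-to-y : iterate (suc d′) s′ ≡ just y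
    s′-to-y = trans (iterate-suc d′ s′) (trans (cong (_>>= step) eu) e)

  ψ-iterate : ∀ m t {x y} → iterate m x ≡ just y → ψ (t + m) x ≡ ψ t y
  ψ-iterate zero t refl = cong (λ k → ψ k _) (+-identityʳ t)
  ψ-iterate (suc m) t {x} e with iterate-first m e
  ... | _ , ex , e′ = trans (cong (λ k → ψ k x) (+-suc t m)) (trans (ψ-step (t + m) ex) (ψ-iterate m t e′))

  chain-depth<N : ∀ {d} → d ≤ n → d < N
  chain-depth<N d≤n = ≤-<-trans d≤n (≤-<-trans (m≤m+n n (2 * n)) 3n<N)

  ψ-injective : ∀ t {x x′} → ψ t x ≡ ψ t x′ → x ≡ x′
  ψ-injective t {x} {x′} e with orbit x | orbit x′
  ... | cyclic c | cyclic c′ with ψ-cyclic′ c t | ψ-cyclic′ c′ t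
  ... | z , cz , ez , q | z′ , cz′ , ez′ , q′ with cycleVertex-injective (trans (sym q) (trans e q′))
  ... | refl = iterate-injective′ (t % N) ez ez′
  ψ-injective t e | cyclic c | chained ¬c′ _ d′ _ s∉W e′ with ψ-cyclic′ c t
  ... | _ , _ , _ , q =
    ⊥-elim (cycleVertex≢chainVertex {c′ = t + d′} {s∉W = s∉W} (trans (sym q) (trans e (ψ-chain ¬c′ t s∉W e′))))
  ψ-injective t e | chained ¬c _ d _ s∉W ex | cyclic c′ with ψ-cyclic′ c′ t
  ... | _ , _ , _ , q =
    ⊥-elim (cycleVertex≢chainVertex {c′ = t + d} {s∉W = s∉W} (trans (sym q) (trans (sym e) (ψ-chain ¬c t s∉W ex))))
  ψ-injective t e | chained ¬c s d d≤n s∉W ex | chained ¬c′ s′ d′ d′≤n s′∉W ex′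
    with chainVertex-injective (trans (sym (ψ-chain ¬c t s∉W ex)) (trans e (ψ-chain ¬c′ t s′∉W ex′)))
  ... | refl , d≈d′ with +-cancelˡ-≈ t (chain-depth<N d≤n) (chain-depth<N d′≤n) d≈d′
  ... | refl = just-injective (trans (sym ex) ex′)

  ψ-surjective : ∀ v → ∃ λ t → ∃ λ x → ψ t x ≡ v
  ψ-surjective ((y , c) , h) with T? (W y)
  ... | no y∉W = toℕ c , y , trans (ψ-chain (y∉W ∘ cyclic-W) (toℕ c) y∉W refl)
                   (vertex-≡ refl (toℕ-injective (trans (toℕ-mod (toℕ c + 0))
                   (trans (cong (_% N) (+-identityʳ (toℕ c))) (m<n⇒m%n≡m (toℕ<n c))))))
  ... | yes y∈W = 0 , y , cyclic-origin c h
    where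
    not-T : ∀ {b} → T (not b) → T b → ⊥
    not-T {false} _ ()
    cyclic-origin : ∀ c (h : T (canonical (y , c))) → ψ 0 y ≡ ((y , c) , h)
    cyclic-origin (suc _) h = ⊥-elim (not-T h y∈W)
    cyclic-origin zero h with Equivalence.to T-∨ h
    ... | inj₁ y∉W = ⊥-elim (not-T y∉W y∈W)
    ... | inj₂ cyclic-y = trans (ψ-cyclic cy 0 refl cy) (vertex-≡ refl refl)
      where
      witness : (c? : Dec (Cyclic y)) → T (does c?) → Cyclic y
      witness (yes cy) _ = cy
      cy = witness (cyclic? y) cyclic-y

  cyclic-class : ∀ {t t′ x x′} → Cyclic x → ψ t x ≡ ψ t′ x′ → Cyclic x′
  cyclic-class {t} {t′} {x} {x′} c q with orbit x′
  ... | cyclic c′ = c′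
  ... | chained ¬c′ _ d′ _ s∉W e′ with ψ-cyclic′ c t
  ... | _ , _ , _ , qz =
    ⊥-elim (cycleVertex≢chainVertex {c′ = t′ + d′} {s∉W = s∉W} (trans (sym qz) (trans q (ψ-chain ¬c′ t′ s∉W e′))))

  same-chain : ∀ {t t′ x x′ s d} (s∉W : ¬ T (W s)) → ¬ Cyclic x → iterate d s ≡ just x → ψ t x ≡ ψ t′ x′ →
               ∃ λ d′ → d′ ≤ n × ¬ Cyclic x′ × iterate d′ s ≡ just x′ × t + d ≈ t′ + d′
  same-chain {t} {t′} {x′ = x′} s∉W ¬c e q with orbit x′
  ... | cyclic c′ = ⊥-elim (¬c (cyclic-class c′ (sym q)))
  ... | chained ¬c′ s′ d′ d′≤n s′∉W e′
    with chainVertex-injective (trans (sym (ψ-chain ¬c t s∉W e)) (trans q (ψ-chain ¬c′ t′ s′∉W e′)))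
  ... | refl , t+d≈t′+d′ = d′ , d′≤n , ¬c′ , e′ , t+d≈t′+d′

  ψ-shift : ∀ {t t′ x x′} k → ψ t x ≡ ψ t′ x′ → ψ (t + k) x ≡ ψ (t′ + k) x′
  ψ-shift {t} {t′} {x} {x′} k q with orbit x
  ... | cyclic c with cyclic-class c q
  ... | c′ with ψ-cyclic′ c t | ψ-cyclic′ c′ t′
  ... | z , cz , ez , qz | z′ , cz′ , ez′ , qz′ with cycleVertex-injective (trans (sym qz) (trans q qz′))
  ... | refl with cyclic-iterate cz k
  ... | w , ew , cw =
    trans (ψ-cyclic c (t + k) (shifted {s = t} c ez) cw) (sym (ψ-cyclic c′ (t′ + k) (shifted {s = t′} c′ ez′) cw))
    where
    shifted : ∀ {y s} → Cyclic y → iterate (s % N) y ≡ just z → iterate ((s + k) % N) y ≡ just w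
    shifted {y} {s} cy e = trans (cyclic-iterate-% cy (s + k)) (trans (iterate-+ s k y)
      (trans (cong (_>>= iterate k) (trans (sym (cyclic-iterate-% cy s)) e)) ew))
  ψ-shift {t} {t′} {x} {x′} k q | chained ¬c s d _ s∉W e with same-chain s∉W ¬c e q
  ... | d′ , _ , ¬c′ , e′ , t+d≈t′+d′ = begin
    ψ (t + k) x                        ≡⟨ ψ-chain ¬c (t + k) s∉W e ⟩
    chainVertex s s∉W (t + k + d)      ≡⟨ chainVertex-cong shifted ⟩
    chainVertex s s∉W (t′ + k + d′)    ≡⟨ ψ-chain ¬c′ (t′ + k) s∉W e′ ⟨
    ψ (t′ + k) x′                      ∎
    where
    open ≡-Reasoning
    swap : ∀ a b c → a + b + c ≡ a + c + b
    swap a b c = trans (+-assoc a b c) (trans (cong (a +_) (+-comm b c)) (sym (+-assoc a c b)))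
    shifted : t + k + d ≈ t′ + k + d′
    shifted = ≈-trans (≈-reflexive (swap t k d)) (≈-trans (+-congʳ-≈ k t+d≈t′+d′) (≈-reflexive (swap t′ d′ k)))

  ψ-link : ∀ {t t′ x x′} → ψ t x ≡ ψ t′ x′ → ¬ Cyclic x →
           (∃ λ m → m ≤ n × t′ + m ≈ t) ⊎ (∃ λ m → m ≤ n × t + m ≈ t′)
  ψ-link {t} {t′} {x} q ¬c with orbit x
  ... | cyclic c = ⊥-elim (¬c c)
  ... | chained _ s d d≤n s∉W e with same-chain s∉W ¬c e q
  ... | d′ , d′≤n , _ , _ , t+d≈t′+d′ with ≤-total d d′
  ... | inj₁ d≤d′ = inj₁ (d′ ∸ d , ≤-trans (m∸n≤m d′ d) d′≤n ,
          +-cancelʳ-≈ d (≈-trans (≈-reflexive (trans (+-assoc t′ (d′ ∸ d) d) (cong (t′ +_) (m∸n+n≡m d≤d′))))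
                                 (≈-sym t+d≈t′+d′)))
  ... | inj₂ d′≤d = inj₂ (d ∸ d′ , ≤-trans (m∸n≤m d d′) d≤n ,
          +-cancelʳ-≈ d′ (≈-trans (≈-reflexive (trans (+-assoc t (d ∸ d′) d′) (cong (t +_) (m∸n+n≡m d′≤d))))
                                  t+d≈t′+d′))

  ψ-transport : ∀ {t t′ x x′} m → ψ t x ≡ ψ t′ x′ → t′ + m ≈ t → Cyclic x ⊎ m ≤ n → iterate m x ≡ just x′
  ψ-transport {t} {t′} {x} {x′} m q t′+m≈t (inj₁ c) with cyclic-iterate c m
  ... | x° , e° , _ = trans e° (cong just (ψ-injective t′ (begin
    ψ t′ x°          ≡⟨ ψ-iterate m t′ e° ⟨
    ψ (t′ + m) x     ≡⟨ ψ-≈ t′+m≈t x ⟩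
    ψ t x            ≡⟨ q ⟩
    ψ t′ x′          ∎)))
    where open ≡-Reasoning
  ψ-transport {t} {t′} {x} {x′} m q t′+m≈t (inj₂ m≤n) with orbit x
  ... | cyclic c = ψ-transport m q t′+m≈t (inj₁ c)
  ... | chained ¬c s d d≤n s∉W e with same-chain s∉W ¬c e q
  ... | d′ , d′≤n , _ , e′ , t+d≈t′+d′ = trans (sym (iterate-+-just d m e)) (trans (cong (λ k → iterate k s) d+m≡d′) e′)
    where
    m+d<N : m + d < N
    m+d<N = ≤-<-trans (+-mono-≤ m≤n d≤n) (≤-<-trans (+-monoʳ-≤ n (m≤m+n n (n + 0))) 3n<N)
    d+m≡d′ : d + m ≡ d′
    d+m≡d′ = trans (+-comm d m) (+-cancelˡ-≈ t′ m+d<N (chain-depth<N d′≤n)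
      (≈-trans (≈-reflexive (sym (+-assoc t′ m d))) (≈-trans (+-congʳ-≈ d t′+m≈t) t+d≈t′+d′)))

  cyclic-present : ∀ {x} → Cyclic x → ∀ t t′ → ∃ λ x′ → ψ t′ x′ ≡ ψ t x
  cyclic-present {x} c t t′ with catch-up t t′
  ... | m , t′+m≈t with cyclic-iterate c m
  ... | x° , e° , _ = x° , trans (sym (ψ-iterate m t′ e°)) (ψ-≈ t′+m≈t x)

  chain-present : ∀ {t x s d} (s∉W : ¬ T (W s)) → ¬ Cyclic x → iterate d s ≡ just x → ∀ t₀ γ → γ ≤ d →
                  t₀ + γ ≈ t + d → ∃ λ y → ψ t₀ y ≡ ψ t x
  chain-present {t} {x} {s} {d} s∉W ¬c e t₀ γ γ≤d t₀+γ≈t+d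
    with iterate-prefix γ (d ∸ γ) (trans (cong (λ k → iterate k s) (m+[n∸m]≡n γ≤d)) e)
  ... | y , ey = y , trans (ψ-chain ¬cy t₀ s∉W ey) (trans (chainVertex-cong t₀+γ≈t+d) (sym (ψ-chain ¬c t s∉W e)))
    where
    ¬cy : ¬ Cyclic y
    ¬cy cy = s∉W (cyclic-W (cyclic-pred* γ ey cy))

  linked : ∀ {t t′ x x′} → ψ t x ≡ ψ t′ x′ →
           (∃ λ m → iterate m x ≡ just x′ × t′ + m ≈ t) ⊎ (∃ λ m → iterate m x′ ≡ just x × t + m ≈ t′)
  linked {t} {t′} {x} q with orbit x
  ... | cyclic c with catch-up t t′
  ... | m , t′+m≈t = inj₁ (m , ψ-transport m q t′+m≈t (inj₁ c) , t′+m≈t)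
  linked q | chained ¬c _ _ _ _ _ with ψ-link q ¬c
  ... | inj₁ (m , m≤n , t′+m≈t) = inj₁ (m , ψ-transport m q t′+m≈t (inj₂ m≤n) , t′+m≈t)
  ... | inj₂ (m , m≤n , t+m≈t′) = inj₂ (m , ψ-transport m (sym q) t+m≈t′ (inj₂ m≤n) , t+m≈t′)

module OrbitGraph (n : ℕ) (G : Graph (Fin n)) (U W : Subset n) (p : Iso (Induced G U) (Induced G W)) where
  open Orbits n G U W p public

  _≟ⱽ_ : DecidableEquality V
  _≟ⱽ_ = ≡-dec (≡-dec _≟ᶠ_ _≟ᶠ_) (λ x y → yes (T-irrelevant x y))

  EdgeAt : ℕ → V → V → Set
  EdgeAt t a b = ∃ λ x → ∃ λ y → ψ t x ≡ a × ψ t y ≡ b × Edge G x y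

  EdgeK : V → V → Set
  EdgeK a b = ∃ λ t → EdgeAt t a b

  EdgeK-sym : ∀ {a b} → EdgeK a b → EdgeK b a
  EdgeK-sym (t , x , y , ex , ey , xy) = t , y , x , ey , ex , Edge-sym G xy

  private
    EdgeK′ : V → V → Set
    EdgeK′ a b = ∃ λ (t : Fin N) → EdgeAt (toℕ t) a b

    edgeK′? : ∀ a b → Dec (EdgeK′ a b)
    edgeK′? a b = any? λ t → any? λ x → any? λ y →
      (ψ (toℕ t) x ≟ⱽ a) ×-dec (ψ (toℕ t) y ≟ⱽ b) ×-dec T? (adj G x y)

    EdgeK⇒EdgeK′ : ∀ {a b} → EdgeK a b → EdgeK′ a b
    EdgeK⇒EdgeK′ (t , x , y , ex , ey , xy) =
      t mod N , x , y , trans (ψ-≈ t≈ x) ex , trans (ψ-≈ t≈ y) ey , xy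
      where t≈ = ≈-trans (mod≈ (cong (_% N) (toℕ-mod t))) (%-≈ t)

  edgeK? : ∀ a b → Dec (EdgeK a b)
  edgeK? a b = map′ (λ (t , e) → toℕ t , e) EdgeK⇒EdgeK′ (edgeK′? a b)

  short-link-adjacency : ∀ {t t′ x x′ y y′} → (∃ λ m → m ≤ n × t′ + m ≈ t) ⊎ (∃ λ m → m ≤ n × t + m ≈ t′) →
                         ψ t x ≡ ψ t′ x′ → ψ t y ≡ ψ t′ y′ → adj G x y ≡ adj G x′ y′
  short-link-adjacency (inj₁ (m , m≤n , c)) qx qy =
    sym (iterate-adj m (ψ-transport m qx c (inj₂ m≤n)) (ψ-transport m qy c (inj₂ m≤n)))
  short-link-adjacency (inj₂ (m , m≤n , c)) qx qy =
    iterate-adj m (ψ-transport m (sym qx) c (inj₂ m≤n)) (ψ-transport m (sym qy) c (inj₂ m≤n))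

  copy-agreement : ∀ {t t′ x x′ y y′} → ψ t x ≡ ψ t′ x′ → ψ t y ≡ ψ t′ y′ → adj G x y ≡ adj G x′ y′
  copy-agreement {t} {t′} {x} {y = y} qx qy with orbit x | orbit y
  ... | chained ¬cx _ _ _ _ _ | _ = short-link-adjacency (ψ-link qx ¬cx) qx qy
  ... | cyclic _ | chained ¬cy _ _ _ _ _ = short-link-adjacency (ψ-link qy ¬cy) qx qy
  ... | cyclic cx | cyclic cy with catch-up t t′
  ... | m , c = sym (iterate-adj m (ψ-transport m qx c (inj₁ cx)) (ψ-transport m qy c (inj₁ cy)))

  edge-in-copy : ∀ {a b t x y} → EdgeK a b → ψ t x ≡ a → ψ t y ≡ b → Edge G x y
  edge-in-copy (_ , _ , _ , ex′ , ey′ , x′y′) ex ey =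
    subst T (sym (copy-agreement (trans ex (sym ex′)) (trans ey (sym ey′)))) x′y′

  K : Graph V
  K = record
    { adj    = λ a b → does (edgeK? a b)
    ; sym    = λ a b → does-≡ (edgeK? a b) (map′ EdgeK-sym EdgeK-sym (edgeK? b a))
    ; irrefl = λ a → dec-false (edgeK? a a) loop-free }
    where
    loop-free : ∀ {a} → ¬ EdgeK a a
    loop-free (t , x , y , ex , ey , xy) = Edge-irrefl G xy (ψ-injective t (trans ex (sym ey)))

  EdgeK⇒Edge : ∀ {a b} → EdgeK a b → Edge K a b
  EdgeK⇒Edge {a} {b} = decided (edgeK? a b)
    where
    decided : ∀ {P : Set} (d : Dec P) → P → T (does d)
    decided (yes _) _ = _
    decided (no ¬P) P = ¬P P

  Edge⇒EdgeK : ∀ {a b} → Edge K a b → EdgeK a b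
  Edge⇒EdgeK {a} {b} = witness (edgeK? a b)
    where
    witness : ∀ {P : Set} (d : Dec P) → T (does d) → P
    witness (yes P) _ = P

  copy : ℕ → InducedEmb G K
  copy t = record { emb = ψ t ; einj = ψ-injective t ; epres = λ x y → T-ext (forth x y) (back x y) }
    where
    forth : ∀ x y → Edge K (ψ t x) (ψ t y) → Edge G x y
    forth x y e = edge-in-copy (Edge⇒EdgeK e) refl refl
    back : ∀ x y → Edge G x y → Edge K (ψ t x) (ψ t y)
    back x y xy = EdgeK⇒Edge (t , x , y , refl , refl , xy)

  private
    representative : V → ℕ × Fin n
    representative v = proj₁ (ψ-surjective v) , proj₁ (proj₂ (ψ-surjective v))

  shift : V → V
  shift v = ψ (suc (proj₁ (representative v))) (proj₂ (representative v))

  unshift : V → V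
  unshift v = ψ (proj₁ (representative v) + period′) (proj₂ (representative v))

  shift-ψ : ∀ t x → shift (ψ t x) ≡ ψ (suc t) x
  shift-ψ t x with ψ-surjective (ψ t x)
  ... | t₀ , x₀ , q = trans (cong (λ k → ψ k x₀) (+-comm 1 t₀)) (trans (ψ-shift 1 q) (cong (λ k → ψ k x) (+-comm t 1)))

  unshift-ψ : ∀ t x → unshift (ψ t x) ≡ ψ (t + period′) x
  unshift-ψ t x with ψ-surjective (ψ t x)
  ... | _ , _ , q = ψ-shift period′ q

  ψ-elim : (P : V → Set) → (∀ t x → P (ψ t x)) → ∀ v → P v
  ψ-elim P P-ψ v with ψ-surjective v
  ... | t , x , q = subst P q (P-ψ t x)

  ψ-turn : ∀ t x → ψ (suc t + period′) x ≡ ψ t x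
  ψ-turn t x = trans (ψ-≈ (≈-reflexive (sym (+-suc t period′))) x) (ψ-≈ (+N-≈ t) x)

  shift-unshift : ∀ v → shift (unshift v) ≡ v
  shift-unshift = ψ-elim (λ v → shift (unshift v) ≡ v) λ t x →
    trans (cong shift (unshift-ψ t x)) (trans (shift-ψ (t + period′) x) (ψ-turn t x))

  unshift-shift : ∀ v → unshift (shift v) ≡ v
  unshift-shift = ψ-elim (λ v → unshift (shift v) ≡ v) λ t x →
    trans (cong unshift (shift-ψ t x)) (trans (unshift-ψ (suc t) x) (ψ-turn t x))

  shift-automorphism : Automorphism K
  shift-automorphism = record
    { bij  = mk⤖ (shift-injective , λ v → unshift v , λ { refl → shift-unshift v })
    ; pres = λ a b → T-ext (back a b) (forth a b) }
    where
    shift-injective : ∀ {a b} → shift a ≡ shift b → a ≡ b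
    shift-injective {a} {b} e = trans (sym (unshift-shift a)) (trans (cong unshift e) (unshift-shift b))
    forth : ∀ a b → Edge K a b → Edge K (shift a) (shift b)
    forth a b e with Edge⇒EdgeK e
    ... | t , x , y , refl , refl , xy = EdgeK⇒Edge (suc t , x , y , sym (shift-ψ t x) , sym (shift-ψ t y) , xy)
    back : ∀ a b → Edge K (shift a) (shift b) → Edge K a b
    back a b e with Edge⇒EdgeK e
    ... | t , x , y , ex , ey , xy = EdgeK⇒Edge (t + period′ , x , y , restore ex , restore ey , xy)
      where
      restore : ∀ {z c} → ψ t z ≡ shift c → ψ (t + period′) z ≡ c
      restore {z} {c} e = trans (sym (unshift-ψ t z)) (trans (cong unshift e) (unshift-shift c))

  shift-extends : ∀ (u : Elem U) → shift (ψ 0 (proj₁ u)) ≡ ψ 0 (proj₁ (isoMap p u))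
  shift-extends (u , u∈U) = trans (shift-ψ 0 u) (ψ-step 0 (step-def u u∈U))

  special-K : Special G → Special K
  special-K sp = special-cover sp λ v → let (t , x , q) = ψ-surjective v in subgraphEmb (copy t) , x , q

-- Bowtie-freeness of the orbit graph

module BowtieFreeness (n : ℕ) (G : Graph (Fin n)) (U W : Subset n) (p : Iso (Induced G U) (Induced G W)) where
  open OrbitGraph n G U W p
  open ArcHelly period′ n 3n<N

  InCopy : ℕ → V → V → V → Set
  InCopy t a b c = ∃ λ x → ∃ λ y → ∃ λ z → ψ t x ≡ a × ψ t y ≡ b × ψ t z ≡ c

  private
    visible-present : ∀ {t t₁ t₂ x₁ x₂ s d₁ d₂} (s∉W : ¬ T (W s)) → ¬ Cyclic x₁ → ¬ Cyclic x₂ →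
                      iterate d₁ s ≡ just x₁ → iterate d₂ s ≡ just x₂ → t₁ + d₁ ≈ t₂ + d₂ → ψ t₁ x₁ ≡ ψ t₂ x₂ →
                      Visible t t₁ d₁ d₂ → ∃ λ y → ψ t y ≡ ψ t₁ x₁
    visible-present s∉W ¬c₁ _ e₁ _ _ _ (δ , h , inj₁ δ≤d₁) = chain-present s∉W ¬c₁ e₁ _ δ δ≤d₁ h
    visible-present s∉W _ ¬c₂ _ e₂ h₁₂ q (δ , h , inj₂ δ≤d₂) with chain-present s∉W ¬c₂ e₂ _ δ δ≤d₂ (≈-trans h h₁₂)
    ... | y , q′ = y , trans q′ (sym q)

  triangle-in-copy : ∀ {a b c} → EdgeK a b → EdgeK b c → EdgeK a c → ∃ λ t → InCopy t a b c
  triangle-in-copy (i , xa , xb , ea , eb , _) (j , xb′ , xc , eb′ , ec , _) (k , xa′ , xc′ , ea′ , ec′ , _)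
    with orbit xa | orbit xb | orbit xc
  ... | cyclic ca | _ | _ with cyclic-present ca i j
  ... | y , q = j , y , xb′ , xc , trans q ea , eb′ , ec
  triangle-in-copy (i , xa , xb , ea , eb , _) (j , xb′ , xc , eb′ , ec , _) (k , xa′ , xc′ , ea′ , ec′ , _)
      | chained _ _ _ _ _ _ | cyclic cb | _ with cyclic-present cb i k
  ... | y , q = k , xa′ , y , xc′ , ea′ , trans q eb , ec′
  triangle-in-copy (i , xa , xb , ea , eb , _) (j , xb′ , xc , eb′ , ec , _) (k , xa′ , xc′ , ea′ , ec′ , _)
      | chained _ _ _ _ _ _ | chained _ _ _ _ _ _ | cyclic cc with cyclic-present cc j i
  ... | y , q = i , xa , xb , y , ea , eb , trans q ec
  triangle-in-copy (i , xa , xb , ea , eb , _) (j , xb′ , xc , eb′ , ec , _) (k , xa′ , xc′ , ea′ , ec′ , _)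
      | chained ¬ca sa α₁ α₁≤ sa∉W qa | chained ¬cb sb β₁ β₁≤ sb∉W qb | chained ¬cc sc γ₂ γ₂≤ sc∉W qc
    with same-chain sa∉W ¬ca qa (trans ea (sym ea′)) | same-chain sb∉W ¬cb qb (trans eb (sym eb′))
       | same-chain sc∉W ¬cc qc (trans ec (sym ec′))
  ... | α₃ , α₃≤ , ¬ca′ , qa′ , ha | β₂ , β₂≤ , ¬cb′ , qb′ , hb | γ₃ , γ₃≤ , ¬cc′ , qc′ , hc
    with arc-helly α₁≤ α₃≤ β₁≤ β₂≤ γ₂≤ γ₃≤ ha hb hc
  ... | inj₁ vis with visible-present sc∉W ¬cc ¬cc′ qc qc′ hc (trans ec (sym ec′)) vis
  ...   | y , q = i , xa , xb , y , ea , eb , trans q ec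
  triangle-in-copy (i , xa , xb , ea , eb , _) (j , xb′ , xc , eb′ , ec , _) (k , xa′ , xc′ , ea′ , ec′ , _)
      | chained ¬ca sa α₁ α₁≤ sa∉W qa | _ | _ | α₃ , _ , ¬ca′ , qa′ , ha | _ | _ | inj₂ (inj₁ vis)
    with visible-present sa∉W ¬ca ¬ca′ qa qa′ ha (trans ea (sym ea′)) vis
  ... | y , q = j , y , xb′ , xc , trans q ea , eb′ , ec
  triangle-in-copy (i , xa , xb , ea , eb , _) (j , xb′ , xc , eb′ , ec , _) (k , xa′ , xc′ , ea′ , ec′ , _)
      | _ | chained ¬cb sb β₁ β₁≤ sb∉W qb | _ | _ | β₂ , _ , ¬cb′ , qb′ , hb | _ | inj₂ (inj₂ vis)
    with visible-present sb∉W ¬cb ¬cb′ qb qb′ hb (trans eb (sym eb′)) vis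
  ... | y , q = k , xa′ , y , xc′ , ea′ , trans q eb , ec′

  CopyTriangle : ℕ → V → V → V → Set
  CopyTriangle t = ImageTriangles.Through (copy t)

  triangle-through : ∀ {v a b} → EdgeK v a → EdgeK a b → EdgeK v b → ∃ λ t → CopyTriangle t v a b
  triangle-through va ab vb with triangle-in-copy va ab vb
  ... | t , x₀ , x , y , e₀ , ex , ey =
    t , x₀ , x , y , e₀ , ex , ey , edge-in-copy va e₀ ex , edge-in-copy vb e₀ ey , edge-in-copy ab ex ey

  open Propagation (Edge K) (Edge-sym K)

  CopyTriangle-≈ : ∀ {t t′ v a b} → t ≈ t′ → CopyTriangle t′ v a b → CopyTriangle t v a b
  CopyTriangle-≈ t≈t′ (w , x , y , ew , ex , ey , tri) =
    w , x , y , trans (ψ-≈ t≈t′ w) ew , trans (ψ-≈ t≈t′ x) ex , trans (ψ-≈ t≈t′ y) ey , tri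

  module _ (bowtieFree : BowtieFree G) (special-W : Special (Induced G W)) where

    -- the certificate of x in W and its pull-back to p⁻¹ x bound the triangles through v in the copies
    -- at times t and t + 1 by the same shape
    step-shape : ∀ {t x v} → T (W x) → ψ t x ≡ v →
                 ∃ λ τ → Witnessed (CopyTriangle t v) τ × CopyTriangle t v ⊑ τ × CopyTriangle (suc t) v ⊑ τ
    step-shape {t} {x} {v} x∈W ψx≡v with special-certificate (Induced G W) special-W (x , x∈W)
    ... | σ , cert =
      mapShape (ψ t) σ-at-x ,
      ImageTriangles.certificate-witnessed (copy t) cert-at-x ψx≡v ,
      ImageTriangles.through-bounded (copy t) _≟ᶠ_ bowtieFree cert-at-x ψx≡v ,
      subst (CopyTriangle (suc t) v ⊑_) shapes-agree
        (ImageTriangles.through-bounded (copy (suc t)) _≟ᶠ_ bowtieFree cert-at-u ψu≡v)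
      where
      open Inverse (⤖⇒↔ (bij p)) using (strictlyInverseˡ)
      into-U : InducedEmb (Induced G W) G
      into-U = inclusion G U ∘ᵢ iso⁻¹-emb p
      σ-at-x = mapShape proj₁ σ
      cert-at-x : Certificate G x σ-at-x
      cert-at-x = certificate-emb (inclusion G W) cert
      cert-at-u : Certificate G (emb into-U (x , x∈W)) (mapShape (emb into-U) σ)
      cert-at-u = certificate-emb into-U cert
      step-back : ∀ z → step (emb into-U z) ≡ just (proj₁ z)
      step-back z = trans (step-def _ _) (cong (just ∘ proj₁) (strictlyInverseˡ z))
      ψu≡v : ψ (suc t) (emb into-U (x , x∈W)) ≡ v
      ψu≡v = trans (ψ-step t (step-back (x , x∈W))) ψx≡v
      shapes-agree : mapShape (ψ (suc t)) (mapShape (emb into-U) σ) ≡ mapShape (ψ t) σ-at-x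
      shapes-agree = trans (mapShape-∘ (ψ (suc t)) (emb into-U) σ)
        (trans (mapShape-cong (λ z → ψ-step t (step-back z)) σ) (sym (mapShape-∘ (ψ t) proj₁ σ)))

    walk : ∀ {σ} → Proper σ → ∀ m {t x y v} → iterate m y ≡ just x → ψ t x ≡ v →
           CopyTriangle t v ⊑ σ → CopyTriangle (t + m) v ⊑ σ
    walk {σ} _ zero {t} {v = v} refl _ at = subst (λ k → CopyTriangle k v ⊑ σ) (sym (+-identityʳ t)) at
    walk {σ} σ-proper (suc m) {t} {v = v} e ψx≡v at with iterate-last m e
    ... | z , ez , sz with step-shape (step-W sz) ψx≡v
    ... | τ , wit , at⊑τ , next⊑τ = subst (λ k → CopyTriangle k v ⊑ σ) (sym (+-suc t m))
      (walk σ-proper m ez (trans (ψ-step t sz) ψx≡v) (propagate σ-proper at wit next⊑τ))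

    linked-collision : ∀ m {t t′ x x′ v a b c d} → ψ t x ≡ v → iterate m x′ ≡ just x → t + m ≈ t′ →
                       CopyTriangle t v a b → CopyTriangle t′ v c d → Collision a b c d
    linked-collision zero {t} _ refl t≈t′ ab cd = inj₁ (ImageTriangles.through-meet (copy t) _≟ᶠ_ bowtieFree ab
      (CopyTriangle-≈ (≈-trans (≈-reflexive (sym (+-identityʳ t))) t≈t′) cd))
    linked-collision (suc m) {t} ψx≡v e t+m≈t′ ab cd with iterate-last m e
    ... | z , ez , sz with step-shape (step-W sz) ψx≡v
    ... | τ , wit , at⊑τ , next⊑τ = admits-collision τ (at⊑τ ab)
      (walk (witnessed-proper (ImageTriangles.through⇒edge (copy t)) wit) m ez (trans (ψ-step t sz) ψx≡v) next⊑τ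
        (CopyTriangle-≈ (≈-trans (≈-reflexive (sym (+-suc t m))) t+m≈t′) cd))

    triangles-collide : ∀ {t₁ t₂ v a b c d} → CopyTriangle t₁ v a b → CopyTriangle t₂ v c d →
                        Collision a b c d
    triangles-collide at₁@(x₀ , _ , _ , e₀ , _) at₂@(y₀ , _ , _ , f₀ , _) with linked (trans e₀ (sym f₀))
    ... | inj₁ (m , x₀→y₀ , h) = collision-swap (linked-collision m f₀ x₀→y₀ h at₂ at₁)
    ... | inj₂ (m , y₀→x₀ , h) = linked-collision m e₀ y₀→x₀ h at₁ at₂

    bowtieFree-K : BowtieFree K
    bowtieFree-K β = collision-injective (inj β)
      (triangles-collide (proj₂ (triangle-through (E 0F 1F tt) (E 1F 2F tt) (E 0F 2F tt)))
                         (proj₂ (triangle-through (E 0F 3F tt) (E 3F 4F tt) (E 0F 4F tt))))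
      where
      E : ∀ i j → Edge Bowtie i j → EdgeK (map β i) (map β j)
      E i j ij = Edge⇒EdgeK (edges β i j ij)

  extension-on : ∀ {m} → BowtieFree G → Special G → Special (Induced G W) → (vertices : Fin m ↔ V) →
                 Σ (Graph (Fin m)) λ K′ → SpecialBowtieFree K′
                   × Σ (InducedEmb G K′) λ e → Σ (Automorphism K′) λ f
                   → ∀ (u : Elem U) → isoMap f (emb e (proj₁ u)) ≡ emb e (proj₁ (isoMap p u))
  extension-on bowtieFree-G special-G special-W vertices =
    relabelled , (bowtieFree (bowtieFree-K bowtieFree-G special-W) , special (special-K special-G)) ,
    inducedEmb (copy 0) , automorphism shift-automorphism ,
    λ u → trans (automorphism-from shift-automorphism (ψ 0 (proj₁ u))) (cong from (shift-extends u))
    where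
    open Relabel K vertices
    open Inverse vertices using (from)

mainTheorem4 : (n : ℕ) (G : Graph (Fin n)) (U W : Subset n)
    → SpecialBowtieFree G
    → SpecialBowtieFree (Induced G U)
    → SpecialBowtieFree (Induced G W)
    → (p : Iso (Induced G U) (Induced G W))
    → Σ ℕ λ m → Σ (Graph (Fin m)) λ K → SpecialBowtieFree K
    × Σ (InducedEmb G K) λ e → Σ (Automorphism K) λ f
    → ∀ (u : Elem U) → isoMap f (emb e (proj₁ u)) ≡ emb e (proj₁ (isoMap p u))
mainTheorem4 n G U W (bowtieFree-G , special-G) _ (_ , special-W) p
  with enumerate-product-filter n _ (OrbitGraph.canonical n G U W p)
... | m , vertices = m , extension-on bowtieFree-G special-G special-W vertices
  where open BowtieFreeness n G U W p
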